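{- For every $\eta>0$ and every integer $q\geqslant2$ there exists $m_0$ such that for every $m\geqslant m_0$ there exists $n_0$ such that for every $n\geqslant n_0$ the following holds. Any $n$-vertex tree $T$ contains forests $T_0\subseteq T_1\subseteq T_2\subseteq T_3\subseteq T_4=T$ such that $T_3$ is a tree and: (1) $|T_0|\leqslant\eta n$; (2) $T_1$ is formed from $T_0$ by the vertex-disjoint addition of trees $S_v$, $v\in V(T_0)$ (where $S_v$ contains $v$ and meets $T_0$ only in $v$), so that for each $v\in V(T_0)$, $S_v-v$ is a forest each of whose component trees has at most $m$ vertices; (3) $T_2$ is the disjoint union of $T_1$ and a forest each of whose component trees has at most $m$ vertices; (4) $T_3$ is formed from $T_2$ by connecting components by paths of length $q$; (5) $|V(T_4)\setminus V(T_2)|\leqslant\eta n$.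
   Context: Here trees and forests are undirected. $|T_0|$ denotes the number of vertices; the length of a path is its number of edges. -}

module Defs where

open import Data.Nat using (ℕ; zero; suc; _+_; _*_; _≤_)
open import Data.Fin using (Fin)
open import Data.List using (List; []; _∷_; _++_; [_]; length; lookup)
open import Data.List.Membership.Propositional using (_∈_)
open import Data.List.Relation.Unary.All using (All)
open import Data.List.Relation.Unary.Unique.Propositional using (Unique)
open import Data.List.Relation.Unary.Linked using (Linked)
open import Data.Product using (Σ; ∃; ∃-syntax; _×_; _,_)
open import Data.Sum using (_⊎_)
open import Relation.Nullary using (¬_)
open import Relation.Binary.PropositionalEquality using (_≡_; _≢_)

_⇔′_ : Set → Set → Set
A ⇔′ B = (A → B) × (B → A)

-- A (simple, undirected) graph whose vertex set is a subset of Fin n,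
-- given by a vertex predicate and an edge relation.
record Graph (n : ℕ) : Set₁ where
  field
    V : Fin n → Set
    E : Fin n → Fin n → Set
open Graph public

record IsGraph {n : ℕ} (G : Graph n) : Set where
  field
    ends : ∀ {x y} → E G x y → V G x × V G y
    sym  : ∀ {x y} → E G x y → E G y x
    loopless : ∀ {x} → ¬ E G x x

_⊆G_ : {n : ℕ} → Graph n → Graph n → Set
H ⊆G G = (∀ {x} → V H x → V G x) × (∀ {x y} → E H x y → E G x y)

data Reach {n : ℕ} (G : Graph n) : Fin n → Fin n → Set where
  here : ∀ {x} → V G x → Reach G x x
  step : ∀ {x y z} → E G x y → Reach G y z → Reach G x z

Connected : {n : ℕ} → Graph n → Set
Connected G = ∀ x y → V G x → V G y → Reach G x y

Cycle : {n : ℕ} → Graph n → Set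
Cycle {n} G = Σ (Fin n) λ v₀ → Σ (List (Fin n)) λ xs →
  (2 ≤ length xs) × Unique (v₀ ∷ xs) × Linked (E G) ((v₀ ∷ xs) ++ [ v₀ ])

IsForest : {n : ℕ} → Graph n → Set
IsForest G = IsGraph G × ¬ Cycle G

IsTree : {n : ℕ} → Graph n → Set
IsTree {n} G = IsForest G × Connected G × (Σ (Fin n) λ v → V G v)

AtMost : {n : ℕ} → (Fin n → Set) → ℕ → Set
AtMost {n} P k = ∀ (xs : List (Fin n)) → Unique xs → All P xs → length xs ≤ k

-- the set P has at most (η · N) elements, where η = (suc a) / (suc b)
AtMostFrac : {n : ℕ} → (Fin n → Set) → ℕ → ℕ → ℕ → Set
AtMostFrac {n} P a b N =
  ∀ (xs : List (Fin n)) → Unique xs → All P xs → suc b * length xs ≤ suc a * N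

SmallComponents : {n : ℕ} → Graph n → ℕ → Set
SmallComponents G m = ∀ v → V G v → AtMost (Reach G v) m

deleteV : {n : ℕ} → Graph n → Fin n → Graph n
deleteV G v = record { V = λ u → V G u × u ≢ v
                     ; E = λ x y → E G x y × x ≢ v × y ≢ v }

SameGraph : {n : ℕ} → Graph n → Graph n → Set
SameGraph G H = (∀ x → V G x ⇔′ V H x) × (∀ x y → E G x y ⇔′ E H x y)

AddPendantTrees : {n : ℕ} → Graph n → Graph n → Graph n → ℕ → Set₁
AddPendantTrees {n} T T₀ T₁ m = Σ (Fin n → Graph n) λ S →
    (∀ v → V T₀ v →
        IsTree (S v) × (S v ⊆G T) × V (S v) v
      × (∀ u → V (S v) u → V T₀ u → u ≡ v)
      × SmallComponents (deleteV (S v) v) m)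
  × (∀ v w → V T₀ v → V T₀ w → v ≢ w → ∀ u → V (S v) u → ¬ V (S w) u)
  × (∀ x → V T₁ x ⇔′ (V T₀ x ⊎ ∃[ v ] (V T₀ v × V (S v) x)))
  × (∀ x y → E T₁ x y ⇔′ (E T₀ x y ⊎ ∃[ v ] (V T₀ v × E (S v) x y)))

AddSmallForest : {n : ℕ} → Graph n → Graph n → Graph n → ℕ → Set₁
AddSmallForest {n} T T₁ T₂ m = Σ (Graph n) λ F →
    IsForest F × (F ⊆G T) × SmallComponents F m
  × (∀ x → V F x → ¬ V T₁ x)
  × (∀ x → V T₂ x ⇔′ (V T₁ x ⊎ V F x))
  × (∀ x y → E T₂ x y ⇔′ (E T₁ x y ⊎ E F x y))

record PathData (n : ℕ) : Set where
  constructor mkPath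
  field
    start    : Fin n
    interior : List (Fin n)
    end      : Fin n
open PathData public

pathVerts : {n : ℕ} → PathData n → List (Fin n)
pathVerts P = start P ∷ interior P ++ [ end P ]

Consec : {n : ℕ} → List (Fin n) → Fin n → Fin n → Set
Consec {n} xs x y = Σ (List (Fin n)) λ ys → Σ (List (Fin n)) λ zs → xs ≡ ys ++ x ∷ y ∷ zs

ConnectByPaths : {n : ℕ} → Graph n → Graph n → Graph n → ℕ → Set
ConnectByPaths {n} T T₂ T₃ q = Σ (List (PathData n)) λ Ps →
    All (λ P → suc (length (interior P)) ≡ q
             × Unique (pathVerts P)
             × Linked (E T) (pathVerts P)
             × V T₂ (start P) × V T₂ (end P)
             × ¬ Reach T₂ (start P) (end P)
             × All (λ u → ¬ V T₂ u) (interior P)) Ps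
  × (∀ i j → i ≢ j → ∀ u → u ∈ interior (lookup Ps i) → ¬ u ∈ interior (lookup Ps j))
  × (∀ x → V T₃ x ⇔′ (V T₂ x ⊎ Σ (PathData n) λ P → P ∈ Ps × x ∈ pathVerts P))
  × (∀ x y → E T₃ x y ⇔′ (E T₂ x y ⊎ Σ (PathData n) λ P → P ∈ Ps ×
                              (Consec (pathVerts P) x y ⊎ Consec (pathVerts P) y x)))

-- an n-vertex tree: a tree on vertex set all of Fin n
IsSpanningTree : {n : ℕ} → Graph n → Set
IsSpanningTree T = IsTree T × (∀ x → V T x)

{-# OPTIONS --safe #-}
-- Root T and call a vertex big if its subtree has at least W vertices; the big vertices form a
-- subtree, and every other vertex is attached to its lowest big ancestor.  A big vertex is thin if
-- it is not the root, has exactly one big child and fewer than W attached vertices, and special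
-- otherwise; counting leaves, branchings and heavy vertices of the big subtree bounds the number of
-- special vertices by 3n/W.  The thin vertices form chains between special vertices.
-- For a window j ≤ b, cut out the q - 1 thin vertices above every big vertex whose depth is
-- 1 + (j + 1)(q - 1) modulo P = 2 + (b + 1)(q - 1), together with the vertices attached to them;
-- these strips become the paths of length q that build T₃.  The windows are disjoint modulo P, so
-- some j cuts at most n/(b + 1) vertices.  Every thin chain now consists of pieces of length less
-- than L = P + q - 1: pieces touching a special vertex v join its pendant tree S v, pieces between
-- two cuts form the forest F, and chains without a cut join T₀, which thus has at most
-- (L + 1) 3n/W vertices; W = 3 (L + 1)(b + 1) makes this n/(b + 1), and all components of
-- S v - v and of F have at most W L vertices.
module Submission where

open import Defs
open import Data.Empty using (⊥; ⊥-elim)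
open import Data.Fin using (Fin; zero; suc; toℕ; fromℕ<)
open import Data.Fin.Properties using (toℕ<n; toℕ-fromℕ<; toℕ-injective; any?) renaming (_≟_ to _≟F_; suc-injective to sucF-injective)
open import Data.List using (List; []; _∷_; _++_; [_]; length; map; filter; allFin; lookup)
open import Data.List.Membership.Propositional using (_∈_)
open import Data.List.Relation.Unary.All using (All; []; _∷_)
open import Data.List.Relation.Unary.AllPairs using ([]; _∷_)
open import Data.List.Relation.Unary.Any using (here; there)
open import Data.List.Relation.Unary.Linked using (Linked; []; [-]; _∷_)
open import Data.List.Relation.Unary.Unique.Propositional using (Unique)
open import Data.Maybe using (Maybe; just; nothing)
open import Data.Nat
open import Data.Nat.DivMod
open import Data.Nat.Properties
open import Data.Product hiding (map)
open import Data.Sum hiding (map)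
open import Relation.Binary.Definitions using (tri<; tri≈; tri>)
open import Relation.Binary.PropositionalEquality hiding ([_])
open import Relation.Nullary
open import Relation.Nullary.Decidable using (_×-dec_; _⊎-dec_; _→-dec_; ¬?; map′; decidable-stable)
import Data.List.Membership.Propositional.Properties as ∈ₚ
import Data.List.Relation.Unary.All as All
import Data.List.Relation.Unary.All.Properties as Allₚ
import Data.List.Relation.Unary.Linked as Linked
import Data.List.Relation.Unary.Unique.Propositional.Properties as Uniqueₚ
open import Algebra.Properties.CommutativeSemigroup +-commutativeSemigroup using (interchange)
open import Function using (id)

𝟙 : {A : Set} → Dec A → ℕ
𝟙 (yes _) = 1
𝟙 (no _) = 0

𝟙-yes : {A : Set} (d : Dec A) → A → 𝟙 d ≡ 1
𝟙-yes (yes _) _ = refl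
𝟙-yes (no ¬a) a = ⊥-elim (¬a a)

𝟙-no : {A : Set} (d : Dec A) → ¬ A → 𝟙 d ≡ 0
𝟙-no (yes a) ¬a = ⊥-elim (¬a a)
𝟙-no (no _) _ = refl

𝟙≤1 : {A : Set} (d : Dec A) → 𝟙 d ≤ 1
𝟙≤1 (yes _) = s≤s z≤n
𝟙≤1 (no _) = z≤n

𝟙-pos : {A : Set} (d : Dec A) → 1 ≤ 𝟙 d → A
𝟙-pos (yes a) _ = a
𝟙-pos (no _) ()

𝟙-mono : {A B : Set} (d : Dec A) (e : Dec B) → (A → B) → 𝟙 d ≤ 𝟙 e
𝟙-mono (yes a) (yes b) f = ≤-refl
𝟙-mono (yes a) (no ¬b) f = ⊥-elim (¬b (f a))
𝟙-mono (no _) e f = z≤n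

𝟙-sym : ∀ {n} (x y : Fin n) → 𝟙 (x ≟F y) ≡ 𝟙 (y ≟F x)
𝟙-sym x y with x ≟F y
... | yes p = sym (𝟙-yes (y ≟F x) (sym p))
... | no ¬p = sym (𝟙-no (y ≟F x) (λ e → ¬p (sym e)))

𝟙-suc : ∀ {n} (i a : Fin n) → 𝟙 (suc i ≟F suc a) ≡ 𝟙 (i ≟F a)
𝟙-suc i a = from-dec (i ≟F a)
  where
  from-dec : (d : Dec (i ≡ a)) → 𝟙 (suc i ≟F suc a) ≡ 𝟙 d
  from-dec (yes p) = 𝟙-yes (suc i ≟F suc a) (cong suc p)
  from-dec (no ¬p) = 𝟙-no (suc i ≟F suc a) (λ e → ¬p (sucF-injective e))

𝟙-× : {A B : Set} (d : Dec A) (e : Dec B) → 𝟙 d * 𝟙 e ≡ 𝟙 (d ×-dec e)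
𝟙-× (yes _) (yes _) = refl
𝟙-× (yes _) (no _) = refl
𝟙-× (no _) _ = refl

∑ : ∀ {n} → (Fin n → ℕ) → ℕ
∑ {zero} f = 0
∑ {suc n} f = f zero + ∑ (λ i → f (suc i))

∑-mono : ∀ {n} {f g : Fin n → ℕ} → (∀ i → f i ≤ g i) → ∑ f ≤ ∑ g
∑-mono {zero} h = z≤n
∑-mono {suc n} h = +-mono-≤ (h zero) (∑-mono (λ i → h (suc i)))

∑-cong : ∀ {n} {f g : Fin n → ℕ} → (∀ i → f i ≡ g i) → ∑ f ≡ ∑ g
∑-cong {zero} h = refl
∑-cong {suc n} h = cong₂ _+_ (h zero) (∑-cong (λ i → h (suc i)))

∑-+ : ∀ {n} (f g : Fin n → ℕ) → ∑ (λ i → f i + g i) ≡ ∑ f + ∑ g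
∑-+ {zero} f g = refl
∑-+ {suc n} f g =
  trans (cong (f zero + g zero +_) (∑-+ (λ i → f (suc i)) (λ i → g (suc i)))) (interchange (f zero) (g zero) (∑ (λ i → f (suc i))) (∑ (λ i → g (suc i))))

∑-*ˡ : ∀ {n} (c : ℕ) (f : Fin n → ℕ) → ∑ (λ i → c * f i) ≡ c * ∑ f
∑-*ˡ {zero} c f = sym (*-zeroʳ c)
∑-*ˡ {suc n} c f =
  trans (cong (c * f zero +_) (∑-*ˡ c (λ i → f (suc i)))) (sym (*-distribˡ-+ c (f zero) _))

∑-const : ∀ {n} (c : ℕ) → ∑ {n} (λ _ → c) ≡ n * c
∑-const {zero} c = refl
∑-const {suc n} c = cong (c +_) (∑-const {n} c)

∑-zero : ∀ {n} → ∑ {n} (λ _ → 0) ≡ 0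
∑-zero {n} = trans (∑-const {n} 0) (*-zeroʳ n)

∑-one : ∀ {n} → ∑ {n} (λ _ → 1) ≡ n
∑-one {n} = trans (∑-const {n} 1) (*-identityʳ n)

∑-swap : ∀ {n m} (f : Fin n → Fin m → ℕ) → ∑ (λ i → ∑ (λ j → f i j)) ≡ ∑ (λ j → ∑ (λ i → f i j))
∑-swap {zero} {m} f = sym (∑-zero {m})
∑-swap {suc n} {m} f = begin
    ∑ (f zero) + ∑ (λ i → ∑ (λ j → f (suc i) j))
  ≡⟨ cong (∑ (f zero) +_) (∑-swap (λ i j → f (suc i) j)) ⟩
    ∑ (f zero) + ∑ (λ j → ∑ (λ i → f (suc i) j))
  ≡⟨ ∑-+ (f zero) (λ j → ∑ (λ i → f (suc i) j)) ⟨
    ∑ (λ j → f zero j + ∑ (λ i → f (suc i) j))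
  ∎
  where open ≡-Reasoning

∑-point : ∀ {n} (f : Fin n → ℕ) (i : Fin n) → f i ≤ ∑ f
∑-point f zero = m≤m+n _ _
∑-point {suc n} f (suc i) = ≤-trans (∑-point (λ j → f (suc j)) i) (m≤n+m _ (f zero))

∑-pos : ∀ {n} (f : Fin n → ℕ) → 1 ≤ ∑ f → ∃ λ i → 1 ≤ f i
∑-pos {zero} f ()
∑-pos {suc n} f h with f zero in eq
... | suc k = zero , subst (1 ≤_) (sym eq) (s≤s z≤n)
... | zero with ∑-pos (λ i → f (suc i)) h
... | i , p = suc i , p

∑-strict : ∀ {n} {f g : Fin n → ℕ} → (∀ i → f i ≤ g i) → (i₀ : Fin n) → f i₀ < g i₀ → ∑ f < ∑ g
∑-strict {suc n} h zero lt = +-mono-<-≤ lt (∑-mono (λ i → h (suc i)))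
∑-strict {suc n} h (suc i₀) lt = +-mono-≤-< (h zero) (∑-strict (λ i → h (suc i)) i₀ lt)

∑-two : ∀ {n} (f : Fin n → ℕ) (i j : Fin n) → i ≢ j → 1 ≤ f i → 1 ≤ f j → 2 ≤ ∑ f
∑-two f zero zero ne _ _ = ⊥-elim (ne refl)
∑-two f zero (suc j) ne p q = +-mono-≤ p (≤-trans q (∑-point (λ k → f (suc k)) j))
∑-two f (suc i) zero ne p q =
  subst (2 ≤_) (+-comm _ (f zero)) (+-mono-≤ (≤-trans p (∑-point (λ k → f (suc k)) i)) q)
∑-two {suc n} f (suc i) (suc j) ne p q =
  ≤-trans (∑-two (λ k → f (suc k)) i j (λ e → ne (cong suc e)) p q) (m≤n+m _ (f zero))

∑-≤1 : ∀ {n} (f : Fin n → ℕ) → (∀ i → f i ≤ 1) → (∀ i j → 1 ≤ f i → 1 ≤ f j → i ≡ j) → ∑ f ≤ 1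
∑-≤1 {zero} f f≤1 unique = z≤n
∑-≤1 {suc n} f f≤1 unique with f zero in eq
... | zero = ∑-≤1 (λ i → f (suc i)) (λ i → f≤1 (suc i))
                 (λ i j p q → sucF-injective (unique (suc i) (suc j) p q))
... | suc k = begin
    suc k + ∑ (λ i → f (suc i))  ≡⟨ cong₂ _+_ (sym eq) rest-zero ⟩
    f zero + 0                   ≤⟨ +-monoˡ-≤ 0 (f≤1 zero) ⟩
    1                            ∎
  where
  open ≤-Reasoning
  rest-zero : ∑ (λ i → f (suc i)) ≡ 0
  rest-zero with ∑ (λ i → f (suc i)) in e
  ... | zero = refl
  ... | suc _ with ∑-pos (λ i → f (suc i)) (subst (1 ≤_) (sym e) (s≤s z≤n))
  ... | i , p with unique zero (suc i) (subst (1 ≤_) (sym eq) (s≤s z≤n)) p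
  ... | ()

∑-select : ∀ {n} (F : Fin n → ℕ) (a : Fin n) → ∑ (λ u → F u * 𝟙 (u ≟F a)) ≡ F a
∑-select {suc n} F zero = begin
    F zero * 1 + ∑ (λ i → F (suc i) * 𝟙 (suc i ≟F zero))
  ≡⟨ cong₂ _+_ (*-identityʳ (F zero)) (∑-cong (λ i → cong (F (suc i) *_) (𝟙-no (suc i ≟F zero) λ ()))) ⟩
    F zero + ∑ (λ i → F (suc i) * 0)
  ≡⟨ cong (F zero +_) (trans (∑-cong (λ i → *-zeroʳ (F (suc i)))) (∑-zero {n})) ⟩
    F zero + 0
  ≡⟨ +-identityʳ (F zero) ⟩
    F zero
  ∎
  where open ≡-Reasoning
∑-select {suc n} F (suc a) = begin
    F zero * 𝟙 (zero ≟F suc a) + ∑ (λ i → F (suc i) * 𝟙 (suc i ≟F suc a))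
  ≡⟨ cong₂ _+_ (cong (F zero *_) (𝟙-no (zero ≟F suc a) λ ())) (∑-cong (λ i → cong (F (suc i) *_) (𝟙-suc i a))) ⟩
    F zero * 0 + ∑ (λ i → F (suc i) * 𝟙 (i ≟F a))
  ≡⟨ cong₂ _+_ (*-zeroʳ (F zero)) (∑-select (λ i → F (suc i)) a) ⟩
    F (suc a)
  ∎
  where open ≡-Reasoning

∑-𝟙≟ : ∀ {n} (a : Fin n) → ∑ (λ i → 𝟙 (i ≟F a)) ≡ 1
∑-𝟙≟ a = trans (∑-cong (λ i → sym (*-identityˡ (𝟙 (i ≟F a))))) (∑-select (λ _ → 1) a)

∑-*𝟙≟ : ∀ {n} (c : ℕ) (a : Fin n) → ∑ (λ i → c * 𝟙 (i ≟F a)) ≡ c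
∑-*𝟙≟ c a = trans (∑-*ˡ c (λ i → 𝟙 (i ≟F a))) (trans (cong (c *_) (∑-𝟙≟ a)) (*-identityʳ c))

∑-fibres : ∀ {n m} (h : Fin n → Fin m) (F : Fin m → ℕ) →
  ∑ (λ y → F (h y)) ≡ ∑ (λ u → F u * ∑ (λ y → 𝟙 (h y ≟F u)))
∑-fibres h F = begin
    ∑ (λ y → F (h y))
  ≡⟨ ∑-cong (λ y → ∑-select F (h y)) ⟨
    ∑ (λ y → ∑ (λ u → F u * 𝟙 (u ≟F h y)))
  ≡⟨ ∑-swap (λ y u → F u * 𝟙 (u ≟F h y)) ⟩
    ∑ (λ u → ∑ (λ y → F u * 𝟙 (u ≟F h y)))
  ≡⟨ ∑-cong (λ u → trans (∑-cong (λ y → cong (F u *_) (𝟙-sym u (h y)))) (∑-*ˡ (F u) (λ y → 𝟙 (h y ≟F u)))) ⟩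
    ∑ (λ u → F u * ∑ (λ y → 𝟙 (h y ≟F u)))
  ∎
  where open ≡-Reasoning

∑-covered : ∀ {n m N} (Q : Fin n → ℕ) (R : Fin m → Fin N → ℕ) (f : Fin m → Fin N → Fin n) →
  (∀ u → Q u ≤ 1) → (∀ u → 1 ≤ Q u → Σ (Fin m) λ s → Σ (Fin N) λ i → u ≡ f s i × 1 ≤ R s i) →
  ∑ Q ≤ ∑ (λ s → ∑ (λ i → R s i))
∑-covered Q R f Q≤1 cover = begin
    ∑ Q
  ≤⟨ ∑-mono pointwise ⟩
    ∑ (λ u → ∑ (λ s → ∑ (λ i → R s i * 𝟙 (u ≟F f s i))))
  ≡⟨ ∑-swap (λ u s → ∑ (λ i → R s i * 𝟙 (u ≟F f s i))) ⟩
    ∑ (λ s → ∑ (λ u → ∑ (λ i → R s i * 𝟙 (u ≟F f s i))))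
  ≡⟨ ∑-cong (λ s → ∑-swap (λ u i → R s i * 𝟙 (u ≟F f s i))) ⟩
    ∑ (λ s → ∑ (λ i → ∑ (λ u → R s i * 𝟙 (u ≟F f s i))))
  ≡⟨ ∑-cong (λ s → ∑-cong (λ i → ∑-*𝟙≟ (R s i) (f s i))) ⟩
    ∑ (λ s → ∑ (λ i → R s i))
  ∎
  where
  open ≤-Reasoning
  term : Fin _ → Fin _ → Fin _ → ℕ
  term u s i = R s i * 𝟙 (u ≟F f s i)
  pointwise : ∀ u → Q u ≤ ∑ (λ s → ∑ (λ i → term u s i))
  pointwise u with Q u in e
  ... | zero = z≤n
  ... | suc k with cover u (subst (1 ≤_) (sym e) (s≤s z≤n))
  ... | s , i , refl , r = begin
      suc k
    ≡⟨ cong suc (n≤0⇒n≡0 (≤-pred (subst (_≤ 1) e (Q≤1 u)))) ⟩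
      1
    ≤⟨ r ⟩
      R s i
    ≡⟨ trans (cong (R s i *_) (𝟙-yes (f s i ≟F f s i) refl)) (*-identityʳ _) ⟨
      term (f s i) s i
    ≤⟨ ∑-point (term (f s i) s) i ⟩
      ∑ (term (f s i) s)
    ≤⟨ ∑-point (λ s′ → ∑ (term (f s i) s′)) s ⟩
      ∑ (λ s′ → ∑ (term (f s i) s′))
    ∎

∑-≤-injection : ∀ {n N} (Q : Fin n → ℕ) (g : Fin n → Fin N) → (∀ u → Q u ≤ 1) →
  (∀ u v → 1 ≤ Q u → 1 ≤ Q v → g u ≡ g v → u ≡ v) → ∑ Q ≤ N
∑-≤-injection {n} {N} Q g Q≤1 inj = begin
    ∑ Q
  ≡⟨ ∑-cong (λ u → ∑-*𝟙≟ (Q u) (g u)) ⟨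
    ∑ (λ u → ∑ (λ t → Q u * 𝟙 (t ≟F g u)))
  ≡⟨ ∑-swap (λ u t → Q u * 𝟙 (t ≟F g u)) ⟩
    ∑ (λ t → ∑ (λ u → Q u * 𝟙 (t ≟F g u)))
  ≤⟨ ∑-mono (λ t → ∑-≤1 (λ u → Q u * 𝟙 (t ≟F g u)) (λ u → *-mono-≤ (Q≤1 u) (𝟙≤1 (t ≟F g u)))
       (λ u v p q → inj u v (support u t p) (support v t q) (trans (sym (hit u t p)) (hit v t q)))) ⟩
    ∑ {N} (λ _ → 1)
  ≡⟨ ∑-one ⟩
    N
  ∎
  where
  open ≤-Reasoning
  support : ∀ u t → 1 ≤ Q u * 𝟙 (t ≟F g u) → 1 ≤ Q u
  support u t p = ≤-trans p (subst (Q u * 𝟙 (t ≟F g u) ≤_) (*-identityʳ (Q u)) (*-monoʳ-≤ (Q u) (𝟙≤1 (t ≟F g u))))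
  hit : ∀ u t → 1 ≤ Q u * 𝟙 (t ≟F g u) → t ≡ g u
  hit u t p with t ≟F g u
  ... | yes e = e
  ... | no _ = ⊥-elim (<⇒≱ p (≤-reflexive (*-zeroʳ (Q u))))

argmin : ∀ {J} (f : Fin (suc J) → ℕ) → ∃ λ j → ∀ i → f j ≤ f i
argmin {zero} f = zero , λ { zero → ≤-refl }
argmin {suc J} f with argmin (λ i → f (suc i))
... | j , p with f zero ≤? f (suc j)
... | yes z≤ = zero , λ { zero → ≤-refl ; (suc i) → ≤-trans z≤ (p i) }
... | no z≰ = suc j , λ { zero → <⇒≤ (≰⇒> z≰) ; (suc i) → p i }

averaging : ∀ {J} (f : Fin (suc J) → ℕ) (N : ℕ) → ∑ f ≤ N → ∃ λ j → suc J * f j ≤ N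
averaging {J} f N h with argmin f
... | j , p = j , ≤-trans (≤-reflexive (sym (∑-const {suc J} (f j)))) (≤-trans (∑-mono p) h)

module _ {n : ℕ} where

  occurrences : List (Fin n) → Fin n → ℕ
  occurrences [] x = 0
  occurrences (y ∷ ys) x = 𝟙 (x ≟F y) + occurrences ys x

  ∑-occurrences : (xs : List (Fin n)) → ∑ (occurrences xs) ≡ length xs
  ∑-occurrences [] = ∑-zero {n}
  ∑-occurrences (y ∷ ys) =
    trans (∑-+ (λ x → 𝟙 (x ≟F y)) (occurrences ys)) (cong₂ _+_ (∑-𝟙≟ y) (∑-occurrences ys))

  occurrences-∉ : (xs : List (Fin n)) (x : Fin n) → ¬ (x ∈ xs) → occurrences xs x ≡ 0
  occurrences-∉ [] x _ = refl
  occurrences-∉ (y ∷ ys) x x∉ =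
    cong₂ _+_ (𝟙-no (x ≟F y) (λ e → x∉ (here e))) (occurrences-∉ ys x (λ m → x∉ (there m)))

  occurrences-unique : (xs : List (Fin n)) → Unique xs → ∀ x → occurrences xs x ≤ 1
  occurrences-unique [] u x = z≤n
  occurrences-unique (y ∷ ys) (y∉ ∷ u) x with x ≟F y
  ... | yes refl = ≤-reflexive (cong suc (occurrences-∉ ys x (λ m → All.lookup y∉ m refl)))
  ... | no _ = occurrences-unique ys u x

  occurrences-pos : (xs : List (Fin n)) (x : Fin n) → 1 ≤ occurrences xs x → x ∈ xs
  occurrences-pos [] x ()
  occurrences-pos (y ∷ ys) x h with x ≟F y
  ... | yes e = here e
  ... | no _ = there (occurrences-pos ys x h)

  length≤∑ : {P : Fin n → Set} (xs : List (Fin n)) → Unique xs → All P xs →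
             (g : Fin n → ℕ) → (∀ x → P x → 1 ≤ g x) → length xs ≤ ∑ g
  length≤∑ xs u all g P⇒pos = ≤-trans (≤-reflexive (sym (∑-occurrences xs))) (∑-mono pointwise)
    where
    pointwise : ∀ x → occurrences xs x ≤ g x
    pointwise x with occurrences xs x in e
    ... | zero = z≤n
    ... | suc zero = P⇒pos x (All.lookup all (occurrences-pos xs x (subst (1 ≤_) (sym e) (s≤s z≤n))))
    ... | suc (suc k) = ⊥-elim (<⇒≱ (s≤s (s≤s z≤n)) (subst (_≤ 1) e (occurrences-unique xs u x)))

module _ {n : ℕ} {G : Graph n} (isG : IsGraph G) where

  reach-++ : ∀ {x y z} → Reach G x y → Reach G y z → Reach G x z
  reach-++ (here _) w = w
  reach-++ (step e w₁) w = step e (reach-++ w₁ w)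

  reach-rev : ∀ {x y} → Reach G x y → Reach G y x
  reach-rev (here v) = here v
  reach-rev (step e w) = reach-++ (reach-rev w) (step (IsGraph.sym isG e) (here (proj₁ (IsGraph.ends isG e))))

  reach-end : ∀ {x y} → Reach G x y → V G y
  reach-end (here vx) = vx
  reach-end (step e w) = reach-end w

  connected-via : (r : Fin n) → V G r → (∀ x → V G x → Reach G x r) → Connected G
  connected-via r vr to-r x y vx vy = reach-++ (to-r x vx) (reach-rev (to-r y vy))

acyclic-⊆ : ∀ {n} {G H : Graph n} → G ⊆G H → ¬ Cycle H → ¬ Cycle G
acyclic-⊆ (_ , sE) noC (v₀ , xs , len , u , lk) = noC (v₀ , xs , len , u , Linked.map sE lk)

module _ {n : ℕ} where

  consec-∈ : ∀ {xs : List (Fin n)} {x y} → Consec xs x y → x ∈ xs × y ∈ xs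
  consec-∈ ([] , zs , refl) = here refl , there (here refl)
  consec-∈ (w ∷ ys , zs , refl) with consec-∈ (ys , zs , refl)
  ... | p , q = there p , there q

  consec-linked : ∀ {R : Fin n → Fin n → Set} {xs x y} → Linked R xs → Consec xs x y → R x y
  consec-linked {R} {x = x} {y} lk (ys , zs , refl) = go ys lk
    where
    go : ∀ ys → Linked R (ys ++ x ∷ y ∷ zs) → R x y
    go [] lk′ = Linked.head lk′
    go (w ∷ ys′) lk′ = go ys′ (Linked.tail lk′)

  consec-irrefl : ∀ {xs : List (Fin n)} {x} → Unique xs → ¬ Consec xs x x
  consec-irrefl (p ∷ _) ([] , zs , refl) = All.head p refl
  consec-irrefl (_ ∷ u) (w ∷ ys , zs , refl) = consec-irrefl u (ys , zs , refl)

record Rooted {n : ℕ} (T : Graph n) : Set where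
  field
    r   : Fin n
    par : Fin n → Fin n
    dep : Fin n → ℕ
    dep-r : dep r ≡ 0
    par-r : par r ≡ r
    par-E : ∀ x → x ≢ r → E T x (par x)
    par-dep : ∀ x → x ≢ r → dep x ≡ suc (dep (par x))

-- Parent and depth are recorded vertex by vertex, following a walk from the root
-- to each vertex and recording every not-yet-recorded vertex with the previous
-- vertex of the walk as parent.
module BuildRooting {n : ℕ} (T : Graph n) (isG : IsGraph T) (r : Fin n) (conn : ∀ x → Reach T r x) where

  ParentMap : Set
  ParentMap = Fin n → Maybe (Fin n × ℕ)

  Recorded : ParentMap → Fin n → Set
  Recorded f x = Σ (Fin n × ℕ) λ pd → f x ≡ just pd

  record Consistent (f : ParentMap) : Set where
    field
      root : f r ≡ just (r , 0)
      good : ∀ x p d → f x ≡ just (p , d) → x ≢ r →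
             E T x p × Σ ℕ λ d' → Σ (Fin n) λ pp → f p ≡ just (pp , d') × d ≡ suc d'
  open Consistent

  set : ParentMap → Fin n → Fin n × ℕ → ParentMap
  set f y v z with z ≟F y
  ... | yes _ = just v
  ... | no _ = f z

  set-≢ : ∀ f y v z → z ≢ y → set f y v z ≡ f z
  set-≢ f y v z ne with z ≟F y
  ... | yes e = ⊥-elim (ne e)
  ... | no _ = refl

  set-≡ : ∀ f y v → set f y v y ≡ just v
  set-≡ f y v with y ≟F y
  ... | yes _ = refl
  ... | no ne = ⊥-elim (ne refl)

  recorded≢unrecorded : ∀ f x y → Recorded f x → f y ≡ nothing → x ≢ y
  recorded≢unrecorded f x y (pd , e) e' refl with trans (sym e) e'
  ... | ()

  set-consistent : ∀ f u y d pu → E T y u → Consistent f → f u ≡ just (pu , d) → f y ≡ nothing →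
                   Consistent (set f y (u , suc d))
  set-consistent f u y d pu e I fu fy = record { root = root′ ; good = good′ }
    where
    f′ = set f y (u , suc d)
    root′ : f′ r ≡ just (r , 0)
    root′ = trans (set-≢ f y _ r (recorded≢unrecorded f r y (_ , root I) fy)) (root I)
    good′ : ∀ x p d₁ → f′ x ≡ just (p , d₁) → x ≢ r →
            E T x p × Σ ℕ λ d' → Σ (Fin n) λ pp → f′ p ≡ just (pp , d') × d₁ ≡ suc d'
    good′ x p d₁ fx x≢r = by-cases (x ≟F y)
      where
      by-cases : Dec (x ≡ y) →
                 E T x p × Σ ℕ λ d' → Σ (Fin n) λ pp → f′ p ≡ just (pp , d') × d₁ ≡ suc d'
      by-cases (yes refl) with trans (sym (set-≡ f x (u , suc d))) fx
      ... | refl = e , d , pu , trans (set-≢ f x _ u (recorded≢unrecorded f u x (_ , fu) fy)) fu , refl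
      by-cases (no x≢y) with good I x p d₁ (trans (sym (set-≢ f y _ x x≢y)) fx) x≢r
      ... | ex , d' , pp , fp , eq = ex , d' , pp , trans (set-≢ f y _ p (recorded≢unrecorded f p y (_ , fp) fy)) fp , eq

  Extends : ParentMap → ParentMap → Set
  Extends f g = ∀ x → Recorded f x → Recorded g x

  record-walk : ∀ f → Consistent f → ∀ {u z} → Recorded f u → Reach T u z →
                Σ ParentMap λ g → Consistent g × Recorded g z × Extends f g
  record-walk f I du (here _) = f , I , du , λ x d → d
  record-walk f I {u} (pd , fu) (step {y = y} e w) with f y in fy
  ... | just pd' = record-walk f I (pd' , fy) w
  record-walk f I {u} ((pu , d) , fu) (step {y = y} e w) | nothing
    with record-walk (set f y (u , suc d)) (set-consistent f u y d pu (IsGraph.sym isG e) I fu fy) (_ , set-≡ f y (u , suc d)) w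
  ... | g , Ig , dz , ext = g , Ig , dz , λ x dx → ext x (_ , trans (set-≢ f y _ x (recorded≢unrecorded f x y dx fy)) (proj₂ dx))

  initial : ParentMap
  initial z with z ≟F r
  ... | yes _ = just (r , 0)
  ... | no _ = nothing

  initial-consistent : Consistent initial
  initial-consistent = record { root = root′ ; good = good′ }
    where
    root′ : initial r ≡ just (r , 0)
    root′ with r ≟F r
    ... | yes _ = refl
    ... | no ne = ⊥-elim (ne refl)
    good′ : ∀ x p d → initial x ≡ just (p , d) → x ≢ r → _
    good′ x p d e ne with x ≟F r
    ... | yes eq = ⊥-elim (ne eq)
    good′ x p d () ne | no _

  record-all : (xs : List (Fin n)) → Σ ParentMap λ g → Consistent g × (∀ x → x ∈ xs → Recorded g x)
  record-all [] = initial , initial-consistent , λ x ()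
  record-all (x ∷ xs) with record-all xs
  ... | g , Ig , dg with record-walk g Ig (_ , Consistent.root Ig) (conn x)
  ... | g' , Ig' , dx , ext = g' , Ig' , λ { y (here refl) → dx ; y (there m) → ext y (dg y m) }

  complete : Σ ParentMap λ g → Consistent g × (∀ x → Recorded g x)
  complete with record-all (allFin n)
  ... | g , Ig , dg = g , Ig , λ x → dg x (∈ₚ.∈-allFin x)

  G : ParentMap
  G = proj₁ complete

  consistentG : Consistent G
  consistentG = proj₁ (proj₂ complete)

  par : Fin n → Fin n
  par x = proj₁ (proj₁ (proj₂ (proj₂ complete) x))

  dep : Fin n → ℕ
  dep x = proj₂ (proj₁ (proj₂ (proj₂ complete) x))

  G-at : ∀ x → G x ≡ just (par x , dep x)
  G-at x = proj₂ (proj₂ (proj₂ complete) x)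

  just-injective : {A : Set} {a b : A} → just a ≡ just b → a ≡ b
  just-injective refl = refl

  root-entry : (par r , dep r) ≡ (r , 0)
  root-entry = just-injective (trans (sym (G-at r)) (Consistent.root consistentG))

  rooted : Rooted T
  rooted = record
    { r = r ; par = par ; dep = dep
    ; dep-r = cong proj₂ root-entry
    ; par-r = cong proj₁ root-entry
    ; par-E = λ x ne → proj₁ (Consistent.good consistentG x (par x) (dep x) (G-at x) ne)
    ; par-dep = λ x ne → par-dep′ x (Consistent.good consistentG x (par x) (dep x) (G-at x) ne)
    }
    where
    par-dep′ : ∀ x → (E T x (par x) × Σ ℕ λ d' → Σ (Fin n) λ pp → G (par x) ≡ just (pp , d') × dep x ≡ suc d') →
               dep x ≡ suc (dep (par x))
    par-dep′ x (_ , d' , pp , e , eq) = trans eq (cong suc (cong proj₂ (just-injective (trans (sym e) (G-at (par x))))))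

spanning-tree-rooted : ∀ {n} (T : Graph n) → IsSpanningTree T → Rooted T
spanning-tree-rooted T (((isG , _) , conn , (r , vr)) , allV) = BuildRooting.rooted T isG r (λ x → conn r x vr (allV x))

module RootedTree {n : ℕ} (T : Graph n) (isG : IsGraph T) (allV : ∀ x → V T x) (R : Rooted T) where

  open Rooted R public

  [m∸n]+[n∸o]≡m∸o : ∀ {m n o} → n ≤ m → o ≤ n → (m ∸ n) + (n ∸ o) ≡ m ∸ o
  [m∸n]+[n∸o]≡m∸o {m} {n} {o} n≤m o≤n = begin
    (m ∸ n) + (n ∸ o) ≡⟨ +-∸-assoc (m ∸ n) o≤n ⟨
    (m ∸ n) + n ∸ o   ≡⟨ cong (_∸ o) (m∸n+n≡m n≤m) ⟩
    m ∸ o             ∎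
    where open ≡-Reasoning

  dep≡0 : ∀ x → dep x ≡ 0 → x ≡ r
  dep≡0 x e with x ≟F r
  ... | yes p = p
  ... | no ne with trans (sym e) (par-dep x ne)
  ... | ()

  ≢r⇒1≤dep : ∀ x → x ≢ r → 1 ≤ dep x
  ≢r⇒1≤dep x ne = subst (1 ≤_) (sym (par-dep x ne)) (s≤s z≤n)

  par≢ : ∀ x → x ≢ r → par x ≢ x
  par≢ x ne e = 1+n≢n (sym (trans (par-dep x ne) (cong (λ y → suc (dep y)) e)))

  up : ℕ → Fin n → Fin n
  up zero x = x
  up (suc i) x = up i (par x)

  up-r : ∀ i → up i r ≡ r
  up-r zero = refl
  up-r (suc i) rewrite par-r = up-r i

  dep-par : ∀ x → dep (par x) ≡ dep x ∸ 1
  dep-par x with x ≟F r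
  ... | yes refl rewrite par-r | dep-r = refl
  ... | no ne rewrite par-dep x ne = refl

  dep-up : ∀ i x → dep (up i x) ≡ dep x ∸ i
  dep-up zero x = refl
  dep-up (suc i) x rewrite dep-up i (par x) | dep-par x = ∸-+-assoc (dep x) 1 i

  up-+ : ∀ i j x → up (i + j) x ≡ up j (up i x)
  up-+ zero j x = refl
  up-+ (suc i) j x = up-+ i j (par x)

  up-suc : ∀ i x → up (suc i) x ≡ par (up i x)
  up-suc i x = trans (cong (λ k → up k x) (+-comm 1 i)) (up-+ i 1 x)

  up-dep : ∀ x → up (dep x) x ≡ r
  up-dep x = dep≡0 _ (trans (dep-up (dep x) x) (n∸n≡0 (dep x)))

  up-beyond-dep : ∀ i x → dep x ≤ i → up i x ≡ r
  up-beyond-dep i x le = begin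
    up i x                              ≡⟨ cong (λ k → up k x) (m+[n∸m]≡n le) ⟨
    up (dep x + (i ∸ dep x)) x          ≡⟨ up-+ (dep x) (i ∸ dep x) x ⟩
    up (i ∸ dep x) (up (dep x) x)       ≡⟨ cong (up (i ∸ dep x)) (up-dep x) ⟩
    up (i ∸ dep x) r                    ≡⟨ up-r (i ∸ dep x) ⟩
    r                                   ∎
    where open ≡-Reasoning

  up≢r⇒<dep : ∀ i x → up i x ≢ r → i < dep x
  up≢r⇒<dep i x ne with i <? dep x
  ... | yes p = p
  ... | no np = ⊥-elim (ne (up-beyond-dep i x (≮⇒≥ np)))

  dep-up-≤ : ∀ h x → h ≤ dep x → dep x ∸ dep (up h x) ≡ h
  dep-up-≤ h x le rewrite dep-up h x = m∸[m∸n]≡n le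

  -- desc v x : x is a descendant of v (possibly v itself)
  desc : Fin n → Fin n → Set
  desc v x = up (dep x ∸ dep v) x ≡ v

  desc? : ∀ v x → Dec (desc v x)
  desc? v x = up (dep x ∸ dep v) x ≟F v

  desc-dep : ∀ {v x} → desc v x → dep v ≤ dep x
  desc-dep {v} {x} d = subst (_≤ dep x) (trans (sym (dep-up (dep x ∸ dep v) x)) (cong dep d)) (m∸n≤m (dep x) (dep x ∸ dep v))

  desc-refl : ∀ x → desc x x
  desc-refl x rewrite n∸n≡0 (dep x) = refl

  desc-eq : ∀ {v x} → desc v x → dep v ≡ dep x → v ≡ x
  desc-eq {v} {x} d e rewrite e | n∸n≡0 (dep x) = sym d

  desc-r : ∀ x → desc r x
  desc-r x rewrite dep-r = up-dep x

  desc-up : ∀ i x → desc (up i x) x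
  desc-up i x with ≤-total i (dep x)
  ... | inj₁ i≤ rewrite dep-up i x | m∸[m∸n]≡n i≤ = refl
  ... | inj₂ d≤ rewrite dep-up i x | m≤n⇒m∸n≡0 d≤ = trans (up-dep x) (sym (up-beyond-dep i x d≤))

  desc-cmp : ∀ {u v x} → desc u x → desc v x → dep u ≤ dep v → desc u v
  desc-cmp {u} {v} {x} du dv le = begin
      up (dep v ∸ dep u) v
    ≡⟨ cong (up (dep v ∸ dep u)) dv ⟨
      up (dep v ∸ dep u) (up (dep x ∸ dep v) x)
    ≡⟨ up-+ (dep x ∸ dep v) (dep v ∸ dep u) x ⟨
      up ((dep x ∸ dep v) + (dep v ∸ dep u)) x
    ≡⟨ cong (λ k → up k x) ([m∸n]+[n∸o]≡m∸o (desc-dep dv) le) ⟩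
      up (dep x ∸ dep u) x
    ≡⟨ du ⟩
      u
    ∎
    where open ≡-Reasoning

  desc-trans : ∀ {u v x} → desc u v → desc v x → desc u x
  desc-trans {u} {v} {x} duv dvx = begin
      up (dep x ∸ dep u) x
    ≡⟨ cong (λ k → up k x) ([m∸n]+[n∸o]≡m∸o (desc-dep dvx) (desc-dep duv)) ⟨
      up ((dep x ∸ dep v) + (dep v ∸ dep u)) x
    ≡⟨ up-+ (dep x ∸ dep v) (dep v ∸ dep u) x ⟩
      up (dep v ∸ dep u) (up (dep x ∸ dep v) x)
    ≡⟨ cong (up (dep v ∸ dep u)) dvx ⟩
      up (dep v ∸ dep u) v
    ≡⟨ duv ⟩
      u
    ∎
    where open ≡-Reasoning

  desc-par : ∀ x → desc (par x) x
  desc-par x = desc-up 1 x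

  desc-to-par : ∀ {v x} → desc v x → x ≢ v → desc v (par x)
  desc-to-par {v} {x} d ne with x ≟F r
  ... | yes refl = ⊥-elim (ne (sym (dep≡0 v (n≤0⇒n≡0 (subst (dep v ≤_) dep-r (desc-dep d))))))
  ... | no xr = desc-cmp d (desc-par x)
                  (≤-pred (subst (dep v <_) (par-dep x xr) (≤∧≢⇒< (desc-dep d) (λ e → ne (sym (desc-eq d e))))))

  desc-from-par : ∀ {v x} → desc v (par x) → desc v x
  desc-from-par {v} {x} d = desc-trans d (desc-par x)

  -- the child of v on the way from v down to its strict descendant y
  child-towards : Fin n → Fin n → Fin n
  child-towards v y = up (dep y ∸ dep v ∸ 1) y

  dep-child-towards : ∀ {v y} → desc v y → y ≢ v → dep (child-towards v y) ≡ suc (dep v)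
  dep-child-towards {v} {y} d ne = trans (dep-up (dep y ∸ dep v ∸ 1) y) (lemma (dep y) (dep v) v<y)
    where
    v<y : dep v < dep y
    v<y = ≤∧≢⇒< (desc-dep d) (λ e → ne (sym (desc-eq d e)))
    lemma : ∀ a b → b < a → a ∸ (a ∸ b ∸ 1) ≡ suc b
    lemma a b b<a = begin
        a ∸ (a ∸ b ∸ 1)               ≡⟨ cong (a ∸_) (pred[m∸n]≡m∸[1+n] a b) ⟩
        a ∸ (a ∸ suc b)               ≡⟨ m∸[m∸n]≡n b<a ⟩
        suc b                         ∎
      where open ≡-Reasoning

  par-child-towards : ∀ {v y} → desc v y → y ≢ v → par (child-towards v y) ≡ v
  par-child-towards {v} {y} d ne = begin
      par (up (dep y ∸ dep v ∸ 1) y)   ≡⟨ up-suc (dep y ∸ dep v ∸ 1) y ⟨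
      up (suc (dep y ∸ dep v ∸ 1)) y   ≡⟨ cong (λ k → up k y) (suc-pred (dep y ∸ dep v) {{>-nonZero (m<n⇒0<n∸m v<y)}}) ⟩
      up (dep y ∸ dep v) y             ≡⟨ d ⟩
      v                                ∎
    where
    open ≡-Reasoning
    v<y : dep v < dep y
    v<y = ≤∧≢⇒< (desc-dep d) (λ e → ne (sym (desc-eq d e)))

  PE : Fin n → Fin n → Set
  PE x y = (x ≢ r × y ≡ par x) ⊎ (y ≢ r × x ≡ par y)

  PE-sym : ∀ {x y} → PE x y → PE y x
  PE-sym (inj₁ p) = inj₂ p
  PE-sym (inj₂ p) = inj₁ p

  PE-E : ∀ {x y} → PE x y → E T x y
  PE-E (inj₁ (ne , refl)) = par-E _ ne
  PE-E (inj₂ (ne , refl)) = IsGraph.sym isG (par-E _ ne)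

  PE-irrefl : ∀ {x} → ¬ PE x x
  PE-irrefl (inj₁ (ne , e)) = par≢ _ ne (sym e)
  PE-irrefl (inj₂ (ne , e)) = par≢ _ ne (sym e)

  Induced : (Fin n → Set) → Graph n
  Induced P = record { V = P ; E = λ x y → PE x y × P x × P y }

  Induced-isGraph : ∀ P → IsGraph (Induced P)
  Induced-isGraph P = record
    { ends = λ (_ , px , py) → px , py
    ; sym = λ (e , px , py) → PE-sym e , py , px
    ; loopless = λ (e , _) → PE-irrefl e }

  Induced-⊆ : ∀ P → Induced P ⊆G T
  Induced-⊆ P = (λ {x} _ → allV x) , λ (e , _) → PE-E e

  Induced-forest : ¬ Cycle T → ∀ P → IsForest (Induced P)
  Induced-forest acyclic P = Induced-isGraph P , acyclic-⊆ (Induced-⊆ P) acyclic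

  desc-child-towards : ∀ {v y} → desc v y → y ≢ v → desc (child-towards v y) y
  desc-child-towards {v} {y} d ne = cong (λ k → up k y) (begin
      dep y ∸ dep (child-towards v y)   ≡⟨ cong (dep y ∸_) (dep-child-towards d ne) ⟩
      dep y ∸ suc (dep v)               ≡⟨ pred[m∸n]≡m∸[1+n] (dep y) (dep v) ⟨
      dep y ∸ dep v ∸ 1                 ∎)
    where open ≡-Reasoning

  <dep⇒up≢r : ∀ i x → i < dep x → up i x ≢ r
  <dep⇒up≢r i x i<dep e = <⇒≱ (m<n⇒0<n∸m i<dep) (≤-reflexive (trans (sym (dep-up i x)) (trans (cong dep e) dep-r)))

module BigVertices {n : ℕ} (T : Graph n) (isG : IsGraph T) (allV : ∀ x → V T x) (R : Rooted T)
                   (W : ℕ) (W≤n : W ≤ n) where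

  open RootedTree T isG allV R public

  opaque
    size : Fin n → ℕ
    size x = ∑ (λ y → 𝟙 (desc? x y))

    size-mono : ∀ {u v} → desc u v → size v ≤ size u
    size-mono d = ∑-mono (λ y → 𝟙-mono (desc? _ y) (desc? _ y) (desc-trans d))

    size-strict : ∀ {u v} → desc u v → u ≢ v → size v < size u
    size-strict {u} {v} d ne = ∑-strict (λ y → 𝟙-mono (desc? v y) (desc? u y) (desc-trans d)) u
      (subst₂ _<_ (sym (𝟙-no (desc? v u) (λ dvu → ne (desc-eq d (≤-antisym (desc-dep d) (desc-dep dvu))))))
                  (sym (𝟙-yes (desc? u u) (desc-refl u))) (s≤s z≤n))

    size-r : size r ≡ n
    size-r = trans (∑-cong (λ y → 𝟙-yes (desc? r y) (desc-r y))) (trans (∑-const {n} 1) (*-identityʳ n))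

    size-def : ∀ x → size x ≡ ∑ (λ y → 𝟙 (desc? x y))
    size-def x = refl

    size-pos : ∀ x → 1 ≤ size x
    size-pos x = ≤-trans (≤-reflexive (sym (𝟙-yes (desc? x x) (desc-refl x)))) (∑-point (λ y → 𝟙 (desc? x y)) x)

  Big : Fin n → Set
  Big x = W ≤ size x

  Big? : ∀ x → Dec (Big x)
  Big? x = W ≤? size x

  Big-up : ∀ {u v} → desc u v → Big v → Big u
  Big-up d b = ≤-trans b (size-mono d)

  Big-r : Big r
  Big-r = subst (W ≤_) (sym size-r) W≤n

  ¬Big⇒≢r : ∀ {x} → ¬ Big x → x ≢ r
  ¬Big⇒≢r nb refl = nb Big-r

  BigChild : Fin n → Fin n → Set
  BigChild c v = c ≢ r × par c ≡ v × Big c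

  BigChild? : ∀ c v → Dec (BigChild c v)
  BigChild? c v = ¬? (c ≟F r) ×-dec ((par c ≟F v) ×-dec Big? c)

  opaque
    #bigChildren : Fin n → ℕ
    #bigChildren v = ∑ (λ c → 𝟙 (BigChild? c v))

    #bigChildren-pos : ∀ v → 1 ≤ #bigChildren v → Σ (Fin n) λ c → BigChild c v
    #bigChildren-pos v h with ∑-pos (λ c → 𝟙 (BigChild? c v)) h
    ... | c , p = c , 𝟙-pos (BigChild? c v) p

    #bigChildren≡1-unique : ∀ {v c c'} → #bigChildren v ≡ 1 → BigChild c v → BigChild c' v → c ≡ c'
    #bigChildren≡1-unique {v} {c} {c'} e b b' with c ≟F c'
    ... | yes p = p
    ... | no ne = ⊥-elim (<⇒≱ (s≤s (s≤s z≤n)) (subst (2 ≤_) e (∑-two (λ k → 𝟙 (BigChild? k v)) c c' ne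
                     (≤-reflexive (sym (𝟙-yes (BigChild? c v) b))) (≤-reflexive (sym (𝟙-yes (BigChild? c' v) b'))))))

    #bigChildren-def : ∀ v → #bigChildren v ≡ ∑ (λ c → 𝟙 (BigChild? c v))
    #bigChildren-def v = refl

  -- att x, the attachment point of x, is the lowest big vertex among x and its ancestors.
  opaque
    attWithin : ℕ → Fin n → Fin n
    attWithin zero x = x
    attWithin (suc f) x with Big? x
    ... | yes _ = x
    ... | no _ = attWithin f (par x)

    att : Fin n → Fin n
    att x = attWithin (dep x) x

    attWithin-Big : ∀ f x → Big x → attWithin f x ≡ x
    attWithin-Big zero x b = refl
    attWithin-Big (suc f) x b with Big? x
    ... | yes _ = refl
    ... | no nb = ⊥-elim (nb b)

    att-Big : ∀ x → Big x → att x ≡ x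
    att-Big x = attWithin-Big (dep x) x

    att-par : ∀ x → ¬ Big x → att x ≡ att (par x)
    att-par x nb with dep x | par-dep x (¬Big⇒≢r nb)
    ... | .(suc (dep (par x))) | refl with Big? x
    ... | yes b = ⊥-elim (nb b)
    ... | no _ = refl

  att-spec : ∀ f x → dep x ≡ f → Big (att x) × desc (att x) x
  att-spec zero x e rewrite dep≡0 x e | att-Big r Big-r = Big-r , desc-refl r
  att-spec (suc f) x e with Big? x
  ... | yes b rewrite att-Big x b = b , desc-refl x
  ... | no nb with att-spec f (par x) (suc-injective (trans (sym (par-dep x (¬Big⇒≢r nb))) e))
  ... | b , d rewrite att-par x nb = b , desc-trans d (desc-par x)

  Big-att : ∀ x → Big (att x)
  Big-att x = proj₁ (att-spec (dep x) x refl)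

  desc-att : ∀ x → desc (att x) x
  desc-att x = proj₂ (att-spec (dep x) x refl)

  att-lowest′ : ∀ f y → dep y ≡ f → ∀ {c} → desc c y → Big c → desc c (att y)
  att-lowest′ f y e {c} d bc with Big? y
  ... | yes b rewrite att-Big y b = d
  att-lowest′ zero y e {c} d bc | no nb = ⊥-elim (nb (subst Big (sym (dep≡0 y e)) Big-r))
  att-lowest′ (suc f) y e {c} d bc | no nb rewrite att-par y nb =
    att-lowest′ f (par y) (suc-injective (trans (sym (par-dep y (¬Big⇒≢r nb))) e))
      (desc-to-par d (λ eq → nb (subst Big (sym eq) bc))) bc

  att-lowest : ∀ y {c} → desc c y → Big c → desc c (att y)
  att-lowest y = att-lowest′ (dep y) y refl

  att-idem : ∀ x → att (att x) ≡ att x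
  att-idem x = att-Big (att x) (Big-att x)

  opaque
    weight : Fin n → ℕ
    weight v = ∑ (λ y → 𝟙 (att y ≟F v))

    ∑-weight : ∑ weight ≡ n
    ∑-weight = begin
        ∑ (λ v → ∑ (λ y → 𝟙 (att y ≟F v)))
      ≡⟨ ∑-swap (λ v y → 𝟙 (att y ≟F v)) ⟩
        ∑ (λ y → ∑ (λ v → 𝟙 (att y ≟F v)))
      ≡⟨ ∑-cong (λ y → trans (∑-cong (λ v → 𝟙-sym (att y) v)) (∑-𝟙≟ (att y))) ⟩
        ∑ {n} (λ _ → 1)
      ≡⟨ trans (∑-const {n} 1) (*-identityʳ n) ⟩
        n
      ∎
      where open ≡-Reasoning

    weight-def : ∀ v → weight v ≡ ∑ (λ y → 𝟙 (att y ≟F v))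
    weight-def v = refl

  thin : Fin n → Set
  thin u = Big u × u ≢ r × #bigChildren u ≡ 1 × weight u < W

  thin? : ∀ u → Dec (thin u)
  thin? u = Big? u ×-dec (¬? (u ≟F r) ×-dec ((#bigChildren u ≟ 1) ×-dec (weight u <? W)))

  thin⇒Big : ∀ {u} → thin u → Big u
  thin⇒Big = proj₁

  thin≢r : ∀ {u} → thin u → u ≢ r
  thin≢r t = proj₁ (proj₂ t)

  thin-one-child : ∀ {u} → thin u → #bigChildren u ≡ 1
  thin-one-child t = proj₁ (proj₂ (proj₂ t))

  thin-light : ∀ {u} → thin u → weight u < W
  thin-light t = proj₂ (proj₂ (proj₂ t))

  special : Fin n → Set
  special u = Big u × ¬ thin u

  special? : ∀ u → Dec (special u)
  special? u = Big? u ×-dec ¬? (thin? u)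

  special≢thin : ∀ {u v} → thin u → special v → u ≢ v
  special≢thin tu sv refl = proj₂ sv tu

  ¬special⇒thin : ∀ {u} → Big u → ¬ special u → thin u
  ¬special⇒thin {u} bu ns with thin? u
  ... | yes t = t
  ... | no nt = ⊥-elim (ns (bu , nt))

  special-r : special r
  special-r = Big-r , λ t → thin≢r t refl

  BigChild-up : ∀ {x} k → Big x → up (suc k) x ≢ r → BigChild (up k x) (up (suc k) x)
  BigChild-up {x} k bx ne =
    (λ e → ne (trans (up-suc k x) (trans (cong par e) par-r))) , sym (up-suc k x) , Big-up (desc-up k x) bx

  -- Each thin vertex has a single big child.
  Big-below-thin-unique : ∀ h x y → Big x → Big y → up h x ≡ up h y →
                          (∀ i → 1 ≤ i → i ≤ h → thin (up i x)) → x ≡ y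
  Big-below-thin-unique zero x y bx by e th = e
  Big-below-thin-unique (suc h) x y bx by e th =
    Big-below-thin-unique h x y bx by same-child (λ i p q → th i p (m≤n⇒m≤1+n q))
    where
    tz : thin (up (suc h) x)
    tz = th (suc h) (s≤s z≤n) ≤-refl
    same-child : up h x ≡ up h y
    same-child = #bigChildren≡1-unique (thin-one-child tz) (BigChild-up h bx (thin≢r tz))
                   (subst (BigChild (up h y)) (sym e) (BigChild-up h by (λ eq → thin≢r tz (trans e eq))))

  ThinAbove : ℕ → Fin n → Set
  ThinAbove h x = ∀ i → 1 ≤ i → i < h → thin (up i x)

  ThinAbove? : ∀ h x → Dec (ThinAbove h x)
  ThinAbove? h x = map′ (λ all i p q → all q p) (λ all {i} q p → all i p q)
                     (allUpTo? (λ i → (1 ≤? i) →-dec thin? (up i x)) h)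

  Between : Fin n → Fin n → Set
  Between top bot = 1 ≤ dep bot ∸ dep top × up (dep bot ∸ dep top) bot ≡ top × ThinAbove (dep bot ∸ dep top) bot

  Between? : ∀ top bot → Dec (Between top bot)
  Between? top bot = (1 ≤? dep bot ∸ dep top) ×-dec ((up (dep bot ∸ dep top) bot ≟F top) ×-dec ThinAbove? _ bot)

  record Between′ (top bot : Fin n) : Set where
    constructor mkBetween′
    field
      h : ℕ
      h≥1 : 1 ≤ h
      h≤ : h ≤ dep bot
      eq : top ≡ up h bot
      ch : ThinAbove h bot

  Between⇒′ : ∀ {top bot} → Between top bot → Between′ top bot
  Between⇒′ {top} {bot} (p , e , th) = mkBetween′ _ p (m∸n≤m (dep bot) (dep top)) (sym e) th

  Between′⇒ : ∀ {top bot} → Between′ top bot → Between top bot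
  Between′⇒ (mkBetween′ h h≥1 h≤ refl ch) rewrite dep-up-≤ h _ h≤ = h≥1 , refl , ch

  Between′-par : ∀ x → x ≢ r → Between′ (par x) x
  Between′-par x ne = mkBetween′ 1 ≤-refl (≢r⇒1≤dep x ne) refl (λ i p q → ⊥-elim (<⇒≱ q p))

  Between′-trans : ∀ {a b c} → Between′ a b → thin b → Between′ b c → Between′ a c
  Between′-trans {a} {b} {c} H₁ tb H₂ = mkBetween′ (h₂ + h₁) (≤-trans (Between′.h≥1 H₁) (m≤n+m h₁ h₂)) le eq chain
    where
    h₁ = Between′.h H₁
    h₂ = Between′.h H₂
    le : h₂ + h₁ ≤ dep c
    le = begin
        h₂ + h₁
      ≤⟨ +-monoʳ-≤ h₂ (subst (h₁ ≤_) (cong dep (Between′.eq H₂)) (Between′.h≤ H₁)) ⟩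
        h₂ + dep (up h₂ c)
      ≡⟨ cong (h₂ +_) (dep-up h₂ c) ⟩
        h₂ + (dep c ∸ h₂)
      ≡⟨ m+[n∸m]≡n (Between′.h≤ H₂) ⟩
        dep c
      ∎
      where open ≤-Reasoning
    eq : a ≡ up (h₂ + h₁) c
    eq = trans (Between′.eq H₁) (trans (cong (up h₁) (Between′.eq H₂)) (sym (up-+ h₂ h₁ c)))
    chain : ThinAbove (h₂ + h₁) c
    chain i p q with <-cmp i h₂
    ... | tri< lt _ _ = Between′.ch H₂ i p lt
    ... | tri≈ _ refl _ = subst thin (Between′.eq H₂) tb
    ... | tri> _ _ gt = subst thin up-i
            (Between′.ch H₁ (i ∸ h₂) (m<n⇒0<n∸m gt)
              (+-cancelˡ-< h₂ (i ∸ h₂) h₁ (subst (_< h₂ + h₁) (sym (m+[n∸m]≡n (<⇒≤ gt))) q)))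
      where
      up-i : up (i ∸ h₂) b ≡ up i c
      up-i = trans (cong (up (i ∸ h₂)) (Between′.eq H₂))
                   (trans (sym (up-+ h₂ (i ∸ h₂) c)) (cong (λ k → up k c) (m+[n∸m]≡n (<⇒≤ gt))))

  Between′-split : ∀ {a c} (H : Between′ a c) k → 1 ≤ k → k < Between′.h H →
                   Between′ a (up k c) × Between′ (up k c) c × thin (up k c)
  Between′-split {a} {c} H k k≥1 k<h = upper , lower , Between′.ch H k k≥1 k<h
    where
    h = Between′.h H
    lower : Between′ (up k c) c
    lower = mkBetween′ k k≥1 (≤-trans (<⇒≤ k<h) (Between′.h≤ H)) refl (λ i p q → Between′.ch H i p (<-trans q k<h))
    upper : Between′ a (up k c)
    upper = mkBetween′ (h ∸ k) (m<n⇒0<n∸m k<h) (subst (h ∸ k ≤_) (sym (dep-up k c)) (∸-monoˡ-≤ k (Between′.h≤ H)))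
              (trans (Between′.eq H) (trans (cong (λ z → up z c) (sym (m+[n∸m]≡n (<⇒≤ k<h)))) (up-+ k (h ∸ k) c)))
              (λ i p q → subst thin (up-+ k i c) (Between′.ch H (k + i) (≤-trans p (m≤n+m i k))
                 (subst (k + i <_) (m+[n∸m]≡n (<⇒≤ k<h)) (+-monoʳ-< k q))))

  Between′-thin-top : ∀ {u v} → (H : Between′ u v) → thin u → ∀ i → 1 ≤ i → i ≤ Between′.h H → thin (up i v)
  Between′-thin-top H tu i p q with m≤n⇒m<n∨m≡n q
  ... | inj₁ lt = Between′.ch H i p lt
  ... | inj₂ refl = subst thin (Between′.eq H) tu

  special-above-unique : ∀ {u v v'} → special v → special v' → Between′ v u → Between′ v' u → v ≡ v'
  special-above-unique {u} sv sv' H H' with <-cmp (Between′.h H) (Between′.h H')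
  ... | tri< lt _ _ = ⊥-elim (proj₂ sv (subst thin (sym (Between′.eq H)) (Between′.ch H' (Between′.h H) (Between′.h≥1 H) lt)))
  ... | tri≈ _ e _ = trans (Between′.eq H) (trans (cong (λ k → up k u) e) (sym (Between′.eq H')))
  ... | tri> _ _ gt = ⊥-elim (proj₂ sv' (subst thin (sym (Between′.eq H')) (Between′.ch H (Between′.h H') (Between′.h≥1 H') gt)))

  special-below-unique-≤ : ∀ {u v v'} → thin u → special v → special v' → (H : Between′ u v) → (H' : Between′ u v') →
                           Between′.h H ≤ Between′.h H' → v ≡ v'
  special-below-unique-≤ {u} {v} {v'} tu sv sv' H H' h≤h' with m≤n⇒m<n∨m≡n h≤h'
  ... | inj₂ e = Big-below-thin-unique h v v' (proj₁ sv) (proj₁ sv')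
                   (trans (sym (Between′.eq H)) (trans (Between′.eq H') (cong (λ k → up k v') (sym e))))
                   (Between′-thin-top H tu)
    where h = Between′.h H
  ... | inj₁ lt = ⊥-elim (proj₂ sv (subst thin (sym v≡y) thin-y))
    where
    h = Between′.h H
    h' = Between′.h H'
    y = up (h' ∸ h) v'
    thin-y : thin y
    thin-y = Between′.ch H' (h' ∸ h) (m<n⇒0<n∸m lt) (∸-monoʳ-< {h'} {h} {0} (Between′.h≥1 H) (<⇒≤ lt))
    v≡y : v ≡ y
    v≡y = Big-below-thin-unique h v y (proj₁ sv) (Big-up (desc-up (h' ∸ h) v') (proj₁ sv'))
            (trans (sym (Between′.eq H)) (trans (Between′.eq H')
              (trans (cong (λ k → up k v') (sym (m∸n+n≡m (<⇒≤ lt)))) (up-+ (h' ∸ h) h v'))))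
            (Between′-thin-top H tu)

  special-below-unique : ∀ {u v v'} → thin u → special v → special v' → Between′ u v → Between′ u v' → v ≡ v'
  special-below-unique tu sv sv' H H' with ≤-total (Between′.h H) (Between′.h H')
  ... | inj₁ le = special-below-unique-≤ tu sv sv' H H' le
  ... | inj₂ ge = sym (special-below-unique-≤ tu sv' sv H' H ge)

  Big-child-of-thin : ∀ {u v x} → Between′ u v → Big v → thin u → BigChild x u → x ≡ v ⊎ (Between′ x v × thin x)
  Big-child-of-thin {u} {v} {x} H bv tu bx with Between′.h H in eh
  ... | zero = ⊥-elim (<⇒≱ (Between′.h≥1 H) (≤-reflexive eh))
  ... | suc zero = inj₁ (#bigChildren≡1-unique (thin-one-child tu) bx (subst (BigChild v) (sym uv) bv'))
    where
    uv : u ≡ up 1 v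
    uv = trans (Between′.eq H) (cong (λ k → up k v) eh)
    bv' : BigChild v (up 1 v)
    bv' = BigChild-up 0 bv (λ e → thin≢r tu (trans uv e))
  ... | suc (suc k) = inj₂ (subst (λ z → Between′ z v) (sym x≡c) lower , subst thin (sym x≡c) thin-c)
    where
    split = Between′-split H (suc k) (s≤s z≤n) (subst (suc k <_) (sym eh) ≤-refl)
    lower = proj₁ (proj₂ split)
    thin-c = proj₂ (proj₂ split)
    uv : u ≡ up (suc (suc k)) v
    uv = trans (Between′.eq H) (cong (λ z → up z v) eh)
    x≡c : x ≡ up (suc k) v
    x≡c = #bigChildren≡1-unique (thin-one-child tu) bx
            (subst (BigChild (up (suc k) v)) (sym uv) (BigChild-up (suc k) bv (λ e → thin≢r tu (trans uv e))))

module SpecialCount {n : ℕ} (T : Graph n) (isG : IsGraph T) (allV : ∀ x → V T x) (R : Rooted T)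
                    (W : ℕ) (W≤n : W ≤ n) where

  open BigVertices T isG allV R W W≤n

  leaf : Fin n → Set
  leaf u = Big u × #bigChildren u ≡ 0

  leaf? : ∀ u → Dec (leaf u)
  leaf? u = Big? u ×-dec (#bigChildren u ≟ 0)

  branching : Fin n → Set
  branching u = Big u × 2 ≤ #bigChildren u

  branching? : ∀ u → Dec (branching u)
  branching? u = Big? u ×-dec (2 ≤? #bigChildren u)

  heavy : Fin n → Set
  heavy u = Big u × W ≤ weight u

  heavy? : ∀ u → Dec (heavy u)
  heavy? u = Big? u ×-dec (W ≤? weight u)

  #leaf #branching #heavy #special : ℕ
  #leaf = ∑ (λ u → 𝟙 (leaf? u))
  #branching = ∑ (λ u → 𝟙 (branching? u))
  #heavy = ∑ (λ u → 𝟙 (heavy? u))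
  #special = ∑ (λ u → 𝟙 (special? u))

  strict-Big-desc⇒Big-child : ∀ {u u'} → desc u u' → u' ≢ u → Big u' → 1 ≤ #bigChildren u
  strict-Big-desc⇒Big-child {u} {u'} d ne bu' = begin
      1                               ≡⟨ 𝟙-yes (BigChild? c u) c-child ⟨
      𝟙 (BigChild? c u)               ≤⟨ ∑-point (λ c → 𝟙 (BigChild? c u)) c ⟩
      ∑ (λ c → 𝟙 (BigChild? c u))    ≡⟨ #bigChildren-def u ⟨
      #bigChildren u                  ∎
    where
    open ≤-Reasoning
    c = child-towards u u'
    c-child : BigChild c u
    c-child = (λ e → 1+n≢0 (trans (sym (dep-child-towards d ne)) (trans (cong dep e) dep-r))) ,
              par-child-towards d ne , Big-up (desc-child-towards d ne) bu'

  -- The subtrees of distinct leaves of the big tree are disjoint and each has at least W vertices.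
  W*#leaf≤n : W * #leaf ≤ n
  W*#leaf≤n = begin
      W * #leaf
    ≡⟨ ∑-*ˡ W (λ u → 𝟙 (leaf? u)) ⟨
      ∑ (λ u → W * 𝟙 (leaf? u))
    ≤⟨ ∑-mono pointwise ⟩
      ∑ (λ u → 𝟙 (leaf? u) * size u)
    ≡⟨ ∑-cong (λ u → trans (∑-cong (λ y → sym (𝟙-× (leaf? u) (desc? u y))))
                       (trans (∑-*ˡ (𝟙 (leaf? u)) (λ y → 𝟙 (desc? u y))) (cong (𝟙 (leaf? u) *_) (sym (size-def u))))) ⟨
      ∑ (λ u → ∑ (λ y → 𝟙 (leaf? u ×-dec desc? u y)))
    ≡⟨ ∑-swap (λ u y → 𝟙 (leaf? u ×-dec desc? u y)) ⟩
      ∑ (λ y → ∑ (λ u → 𝟙 (leaf? u ×-dec desc? u y)))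
    ≤⟨ ∑-mono (λ y → ∑-≤1 _ (λ u → 𝟙≤1 (leaf? u ×-dec desc? u y))
         (λ u u' p q → leaf-above-unique y (𝟙-pos (leaf? u ×-dec desc? u y) p) (𝟙-pos (leaf? u' ×-dec desc? u' y) q))) ⟩
      ∑ {n} (λ _ → 1)
    ≡⟨ ∑-one ⟩
      n
    ∎
    where
    open ≤-Reasoning
    pointwise : ∀ u → W * 𝟙 (leaf? u) ≤ 𝟙 (leaf? u) * size u
    pointwise u with leaf? u
    ... | yes (bu , _) = subst₂ _≤_ (sym (*-identityʳ W)) (sym (+-identityʳ (size u))) bu
    ... | no _ = ≤-reflexive (*-zeroʳ W)
    below : ∀ {y u u'} → leaf u × desc u y → leaf u' × desc u' y → dep u ≤ dep u' → u ≡ u'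
    below {u = u} {u'} (lu , du) (lu' , du') le with u' ≟F u
    ... | yes e = sym e
    ... | no ne = ⊥-elim (<⇒≱ (strict-Big-desc⇒Big-child (desc-cmp du du' le) ne (proj₁ lu')) (≤-reflexive (proj₂ lu)))
    leaf-above-unique : ∀ y {u u'} → leaf u × desc u y → leaf u' × desc u' y → u ≡ u'
    leaf-above-unique y {u} {u'} l l' with ≤-total (dep u) (dep u')
    ... | inj₁ le = below l l' le
    ... | inj₂ le = sym (below l' l le)

  W*#heavy≤n : W * #heavy ≤ n
  W*#heavy≤n = begin
      W * #heavy                 ≡⟨ ∑-*ˡ W (λ u → 𝟙 (heavy? u)) ⟨
      ∑ (λ u → W * 𝟙 (heavy? u))  ≤⟨ ∑-mono pointwise ⟩
      ∑ weight                   ≡⟨ ∑-weight ⟩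
      n                          ∎
    where
    open ≤-Reasoning
    pointwise : ∀ u → W * 𝟙 (heavy? u) ≤ weight u
    pointwise u with heavy? u
    ... | yes (_ , le) = subst (_≤ weight u) (sym (*-identityʳ W)) le
    ... | no _ = subst (_≤ weight u) (sym (*-zeroʳ W)) z≤n

  NonRootBig : Fin n → Set
  NonRootBig c = c ≢ r × Big c

  NonRootBig? : ∀ c → Dec (NonRootBig c)
  NonRootBig? c = ¬? (c ≟F r) ×-dec Big? c

  𝟙-BigChild : ∀ c u → 𝟙 (BigChild? c u) ≡ 𝟙 (NonRootBig? c) * 𝟙 (u ≟F par c)
  𝟙-BigChild c u with BigChild? c u | NonRootBig? c | u ≟F par c
  ... | yes _ | yes _ | yes _ = refl
  ... | yes (_ , e , _) | _ | no ne = ⊥-elim (ne (sym e))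
  ... | yes (cr , _ , bc) | no ncb | _ = ⊥-elim (ncb (cr , bc))
  ... | no _ | no _ | _ = refl
  ... | no _ | yes _ | no _ = refl
  ... | no nb | yes (cr , bc) | yes e = ⊥-elim (nb (cr , sym e , bc))

  -- Every big vertex except the root is the big child of exactly one vertex.
  ∑-#bigChildren : ∑ #bigChildren + 1 ≡ ∑ (λ u → 𝟙 (Big? u))
  ∑-#bigChildren = begin
      ∑ #bigChildren + 1
    ≡⟨ cong (_+ 1) (trans (∑-cong #bigChildren-def) (∑-swap (λ u c → 𝟙 (BigChild? c u)))) ⟩
      ∑ (λ c → ∑ (λ u → 𝟙 (BigChild? c u))) + 1
    ≡⟨ cong (_+ 1) (∑-cong (λ c → trans (∑-cong (𝟙-BigChild c)) (∑-*𝟙≟ (𝟙 (NonRootBig? c)) (par c)))) ⟩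
      ∑ (λ c → 𝟙 (NonRootBig? c)) + 1
    ≡⟨ cong (∑ (λ c → 𝟙 (NonRootBig? c)) +_) (∑-𝟙≟ r) ⟨
      ∑ (λ c → 𝟙 (NonRootBig? c)) + ∑ (λ c → 𝟙 (c ≟F r))
    ≡⟨ ∑-+ (λ c → 𝟙 (NonRootBig? c)) (λ c → 𝟙 (c ≟F r)) ⟨
      ∑ (λ c → 𝟙 (NonRootBig? c) + 𝟙 (c ≟F r))
    ≡⟨ ∑-cong (λ c → pointwise c (c ≟F r) (Big? c)) ⟩
      ∑ (λ u → 𝟙 (Big? u))
    ∎
    where
    open ≡-Reasoning
    pointwise : ∀ c (d : Dec (c ≡ r)) (e : Dec (Big c)) → 𝟙 (NonRootBig? c) + 𝟙 d ≡ 𝟙 e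
    pointwise c (yes refl) e = trans (cong (_+ 1) (𝟙-no (NonRootBig? r) (λ z → proj₁ z refl))) (sym (𝟙-yes e Big-r))
    pointwise c (no ne) (yes b) = cong (_+ 0) (𝟙-yes (NonRootBig? c) (ne , b))
    pointwise c (no ne) (no nb) = cong (_+ 0) (𝟙-no (NonRootBig? c) (λ z → nb (proj₂ z)))

  -- Counting big vertices with multiplicity of their big children: a tree has more leaves than branchings.
  #branching<#leaf : #branching + 1 ≤ #leaf
  #branching<#leaf = +-cancelˡ-≤ (∑ #bigChildren) (#branching + 1) #leaf (begin
      ∑ #bigChildren + (#branching + 1)
    ≡⟨ trans (cong (∑ #bigChildren +_) (+-comm #branching 1)) (sym (+-assoc (∑ #bigChildren) 1 #branching)) ⟩
      ∑ #bigChildren + 1 + #branching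
    ≡⟨ cong (_+ #branching) ∑-#bigChildren ⟩
      ∑ (λ u → 𝟙 (Big? u)) + #branching
    ≡⟨ ∑-+ (λ u → 𝟙 (Big? u)) (λ u → 𝟙 (branching? u)) ⟨
      ∑ (λ u → 𝟙 (Big? u) + 𝟙 (branching? u))
    ≤⟨ ∑-mono (λ u → pointwise u (Big? u) (branching? u) (leaf? u)) ⟩
      ∑ (λ u → #bigChildren u + 𝟙 (leaf? u))
    ≡⟨ ∑-+ #bigChildren (λ u → 𝟙 (leaf? u)) ⟩
      ∑ #bigChildren + #leaf
    ∎)
    where
    open ≤-Reasoning
    pointwise : ∀ u (d : Dec (Big u)) (e : Dec (branching u)) (f : Dec (leaf u)) → 𝟙 d + 𝟙 e ≤ #bigChildren u + 𝟙 f
    pointwise u (no nb) (yes (b , _)) f = ⊥-elim (nb b)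
    pointwise u (no nb) (no _) f = z≤n
    pointwise u (yes b) (yes (_ , le)) (yes (_ , e0)) = ⊥-elim (<⇒≱ (s≤s z≤n) (subst (2 ≤_) e0 le))
    pointwise u (yes b) (yes (_ , le)) (no _) = subst (2 ≤_) (sym (+-identityʳ (#bigChildren u))) le
    pointwise u (yes b) (no _) (yes _) = m≤n+m 1 (#bigChildren u)
    pointwise u (yes b) (no _) (no nl) = subst (1 ≤_) (sym (+-identityʳ (#bigChildren u))) (n≢0⇒n>0 (λ e → nl (b , e)))

  𝟙-special≤ : ∀ u → 𝟙 (special? u) ≤ 𝟙 (u ≟F r) + 𝟙 (leaf? u) + 𝟙 (branching? u) + 𝟙 (heavy? u)
  𝟙-special≤ u = go (special? u) (u ≟F r) (leaf? u) (branching? u) (heavy? u)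
    where
    go : (d : Dec (special u)) (e : Dec (u ≡ r)) (f : Dec (leaf u)) (g : Dec (branching u)) (h : Dec (heavy u)) →
         𝟙 d ≤ 𝟙 e + 𝟙 f + 𝟙 g + 𝟙 h
    go (no _) e f g h = z≤n
    go (yes _) (yes _) f g h = s≤s z≤n
    go (yes _) (no _) (yes _) g h = s≤s z≤n
    go (yes _) (no _) (no _) (yes _) h = s≤s z≤n
    go (yes _) (no _) (no _) (no _) (yes _) = s≤s z≤n
    go (yes (bu , nth)) (no ner) (no nl) (no nbr) (no nhw) = ⊥-elim (nth (bu , ner , one-child , ≰⇒> (λ le → nhw (bu , le))))
      where
      one-child : #bigChildren u ≡ 1
      one-child = ≤-antisym (≤-pred (≰⇒> (λ le → nbr (bu , le)))) (n≢0⇒n>0 (λ e → nl (bu , e)))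

  #special≤ : #special ≤ #leaf + #leaf + #heavy
  #special≤ = begin
      #special
    ≤⟨ ∑-mono 𝟙-special≤ ⟩
      ∑ (λ u → 𝟙 (u ≟F r) + 𝟙 (leaf? u) + 𝟙 (branching? u) + 𝟙 (heavy? u))
    ≡⟨ trans (∑-+ _ (λ u → 𝟙 (heavy? u))) (cong (_+ #heavy) (trans (∑-+ _ (λ u → 𝟙 (branching? u)))
         (cong (_+ #branching) (trans (∑-+ (λ u → 𝟙 (u ≟F r)) (λ u → 𝟙 (leaf? u))) (cong (_+ #leaf) (∑-𝟙≟ r)))))) ⟩
      1 + #leaf + #branching + #heavy
    ≡⟨ cong (_+ #heavy) (trans (+-assoc 1 #leaf #branching) (trans (cong (1 +_) (+-comm #leaf #branching)) (sym (+-assoc 1 #branching #leaf)))) ⟩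
      1 + #branching + #leaf + #heavy
    ≤⟨ +-monoˡ-≤ #heavy (+-monoˡ-≤ #leaf (subst (_≤ #leaf) (+-comm #branching 1) #branching<#leaf)) ⟩
      #leaf + #leaf + #heavy
    ∎
    where open ≤-Reasoning

  W*#special≤3n : W * #special ≤ 3 * n
  W*#special≤3n = begin
      W * #special                                ≤⟨ *-monoʳ-≤ W #special≤ ⟩
      W * (#leaf + #leaf + #heavy)                ≡⟨ trans (*-distribˡ-+ W (#leaf + #leaf) #heavy) (cong (_+ W * #heavy) (*-distribˡ-+ W #leaf #leaf)) ⟩
      W * #leaf + W * #leaf + W * #heavy          ≤⟨ +-mono-≤ (+-mono-≤ W*#leaf≤n W*#leaf≤n) W*#heavy≤n ⟩
      n + n + n                                   ≡⟨ +-assoc n n n ⟩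
      n + (n + n)                                 ≡⟨ cong (λ z → n + (n + z)) (+-identityʳ n) ⟨
      3 * n                                       ∎
    where open ≤-Reasoning

module Residues (P : ℕ) {{_ : NonZero P}} where

  [r+K*P]%P≡r : ∀ r K → r < P → (r + K * P) % P ≡ r
  [r+K*P]%P≡r r K r<P = trans ([m+kn]%n≡m%n r K P) (m<n⇒m%n≡m r<P)

  descend-to-residue : ∀ d t → t ≤ d → d ∸ (d ∸ t) % P ≡ t + (d ∸ t) / P * P
  descend-to-residue d t t≤d = begin
      d ∸ i₀
    ≡⟨ cong (_∸ i₀) (m+[n∸m]≡n t≤d) ⟨
      t + (d ∸ t) ∸ i₀
    ≡⟨ cong (λ z → t + z ∸ i₀) (m≡m%n+[m/n]*n (d ∸ t) P) ⟩
      t + (i₀ + K * P) ∸ i₀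
    ≡⟨ cong (_∸ i₀) (+-comm t (i₀ + K * P)) ⟩
      i₀ + K * P + t ∸ i₀
    ≡⟨ cong (_∸ i₀) (+-assoc i₀ (K * P) t) ⟩
      i₀ + (K * P + t) ∸ i₀
    ≡⟨ m+n∸m≡n i₀ (K * P + t) ⟩
      K * P + t
    ≡⟨ +-comm (K * P) t ⟩
      t + K * P
    ∎
    where
    open ≡-Reasoning
    i₀ = (d ∸ t) % P
    K = (d ∸ t) / P

module Strips {n : ℕ} (T : Graph n) (isG : IsGraph T) (allV : ∀ x → V T x) (R : Rooted T)
              (W : ℕ) (W≤n : W ≤ n) (q₁ J j : ℕ) (q₁≥1 : 1 ≤ q₁) (j≤J : j ≤ J) where

  open BigVertices T isG allV R W W≤n public

  P : ℕ
  P = 2 + suc J * q₁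

  t : ℕ
  t = suc (suc j * q₁)

  open Residues P public

  t<P : t < P
  t<P = s≤s (s≤s (*-monoˡ-≤ q₁ (s≤s j≤J)))

  q₁<t : q₁ < t
  q₁<t = s≤s (m≤m+n q₁ (j * q₁))

  <q₁⇒suc≤t : ∀ {i} → i < q₁ → suc i ≤ t
  <q₁⇒suc≤t i<q₁ = <⇒≤ (≤-<-trans i<q₁ q₁<t)

  StripStart : Fin n → Set
  StripStart c = Big c × dep c % P ≡ t × ThinAbove (suc q₁) c

  StripStart? : ∀ c → Dec (StripStart c)
  StripStart? c = Big? c ×-dec ((dep c % P ≟ t) ×-dec ThinAbove? (suc q₁) c)

  -- X: the interior vertices of the strips, which are cut out of the tree
  X : Fin n → Set
  X u = Σ (Fin n) λ c → StripStart c × ∃ λ i → i < q₁ × u ≡ up (suc i) c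

  X? : ∀ u → Dec (X u)
  X? u = any? (λ c → StripStart? c ×-dec anyUpTo? (λ i → u ≟F up (suc i) c) q₁)

  StripStart-thin : ∀ {c} → StripStart c → ∀ i → 1 ≤ i → i ≤ q₁ → thin (up i c)
  StripStart-thin (_ , _ , th) i p q = th i p (s≤s q)

  X-thin : ∀ {u} → X u → thin u
  X-thin (c , st , i , i<q₁ , refl) = StripStart-thin st (suc i) (s≤s z≤n) i<q₁

  X-Big : ∀ {u} → X u → Big u
  X-Big x = thin⇒Big (X-thin x)

  StripStart-dep : ∀ {c} → StripStart c → dep c ≡ t + dep c / P * P
  StripStart-dep {c} (_ , res , _) = trans (m≡m%n+[m/n]*n (dep c) P) (cong (_+ dep c / P * P) res)

  StripStart-up-residue : ∀ {c} → StripStart c → ∀ i → i ≤ t → dep (up i c) % P ≡ t ∸ i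
  StripStart-up-residue {c} st i i≤t = begin
      dep (up i c) % P                     ≡⟨ cong (_% P) (dep-up i c) ⟩
      (dep c ∸ i) % P                      ≡⟨ cong (λ d → (d ∸ i) % P) (StripStart-dep st) ⟩
      (t + dep c / P * P ∸ i) % P          ≡⟨ cong (_% P) (+-∸-comm (dep c / P * P) i≤t) ⟩
      (t ∸ i + dep c / P * P) % P          ≡⟨ [r+K*P]%P≡r (t ∸ i) (dep c / P) (≤-<-trans (m∸n≤m t i) t<P) ⟩
      t ∸ i                                ∎
    where open ≡-Reasoning

  StripStart-deep : ∀ {c} → StripStart c → suc q₁ ≤ dep c
  StripStart-deep {c} st = subst (suc q₁ ≤_) (sym (StripStart-dep st)) (≤-trans q₁<t (m≤m+n t (dep c / P * P)))

  StripStart-up≢r : ∀ {c} → StripStart c → ∀ i → i ≤ q₁ → up i c ≢ r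
  StripStart-up≢r {c} st i i≤q₁ = <dep⇒up≢r i c (<-≤-trans (s≤s i≤q₁) (StripStart-deep st))

  InWindow : ℕ → ℕ → Set
  InWindow j′ ρ = j′ * q₁ < ρ × ρ ≤ suc j′ * q₁

  X-window : ∀ {u} → X u → InWindow j (dep u % P)
  X-window (c , st , i , i<q₁ , refl) rewrite StripStart-up-residue st (suc i) (<q₁⇒suc≤t i<q₁) =
    subst (j * q₁ <_) (sym (+-∸-comm (j * q₁) (<⇒≤ i<q₁))) (+-monoˡ-≤ (j * q₁) (m<n⇒0<n∸m i<q₁)) ,
    m∸n≤m (q₁ + j * q₁) i

  StripStart-¬X : ∀ {c} → StripStart c → ¬ X c
  StripStart-¬X (_ , res , _) x = <⇒≱ ≤-refl (subst (_≤ suc j * q₁) res (proj₂ (X-window x)))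

  StripEnd-¬X : ∀ {c} → StripStart c → ¬ X (up (suc q₁) c)
  StripEnd-¬X st x = <⇒≱ (proj₁ (X-window x))
    (≤-reflexive (trans (StripStart-up-residue st (suc q₁) q₁<t) (m+n∸m≡n q₁ (j * q₁))))

  strips-disjoint : ∀ {c c' i i'} → StripStart c → StripStart c' → i < q₁ → i' < q₁ →
                    up (suc i) c ≡ up (suc i') c' → c ≡ c'
  strips-disjoint {c} {c'} {i} {i'} st st' i<q₁ i'<q₁ e =
    Big-below-thin-unique (suc i) c c' (proj₁ st) (proj₁ st')
      (trans e (cong (λ k → up (suc k) c') (sym i≡i'))) (λ k p q → StripStart-thin st k p (≤-trans q i<q₁))
    where
    i≡i' : i ≡ i'
    i≡i' = suc-injective (∸-cancelˡ-≡ (<q₁⇒suc≤t i<q₁) (<q₁⇒suc≤t i'<q₁)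
             (trans (sym (StripStart-up-residue st (suc i) (<q₁⇒suc≤t i<q₁)))
               (trans (cong (λ z → dep z % P) e) (StripStart-up-residue st' (suc i') (<q₁⇒suc≤t i'<q₁)))))

  -- Among any P consecutive depths one is ≡ t (mod P), so a thin chain of length P + q₁ contains a strip.
  long-chain-StripStart : ∀ x → Big x → ThinAbove (P + q₁) x → Σ ℕ λ i₀ → i₀ < P × StripStart (up i₀ x)
  long-chain-StripStart x bx th = i₀ , m%n<n (dep x ∸ t) P , Big-up (desc-up i₀ x) bx , residue , thin-above
    where
    i₀ = (dep x ∸ t) % P
    P<dep : P < dep x
    P<dep = up≢r⇒<dep P x (thin≢r (th P (≤-trans (s≤s z≤n) (<⇒≤ t<P)) (m<m+n P q₁≥1)))
    residue : dep (up i₀ x) % P ≡ t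
    residue = trans (cong (_% P) (trans (dep-up i₀ x) (descend-to-residue (dep x) t (<⇒≤ (<-trans t<P P<dep)))))
                    ([r+K*P]%P≡r t ((dep x ∸ t) / P) t<P)
    thin-above : ThinAbove (suc q₁) (up i₀ x)
    thin-above k p (s≤s k≤q₁) =
      subst thin (up-+ i₀ k x) (th (i₀ + k) (≤-trans p (m≤n+m k i₀)) (+-mono-<-≤ (m%n<n (dep x ∸ t) P) k≤q₁))

module Roles {n : ℕ} (T : Graph n) (isG : IsGraph T) (allV : ∀ x → V T x) (R : Rooted T)
             (W : ℕ) (W≤n : W ≤ n) (q₁ J j : ℕ) (q₁≥1 : 1 ≤ q₁) (j≤J : j ≤ J) where

  open Strips T isG allV R W W≤n q₁ J j q₁≥1 j≤J public

  -- Kept x : the vertex x survives in T₂, i.e. it does not hang from a cut-out strip vertex.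
  Kept : Fin n → Set
  Kept x = ¬ X (att x)

  Kept? : ∀ x → Dec (Kept x)
  Kept? x = ¬? (X? (att x))

  Kept⇒¬X : ∀ {u} → Big u → Kept u → ¬ X u
  Kept⇒¬X {u} b k = subst (λ z → ¬ X z) (att-Big u b) k

  ¬X⇒Kept : ∀ {u} → Big u → ¬ X u → Kept u
  ¬X⇒Kept {u} b k = subst (λ z → ¬ X z) (sym (att-Big u b)) k

  Kept-att : ∀ x → Kept x → Kept (att x)
  Kept-att x k = subst (λ z → ¬ X z) (sym (att-idem x)) k

  special-Kept : ∀ {v} → special v → Kept v
  special-Kept sv = ¬X⇒Kept (proj₁ sv) (λ xv → proj₂ sv (X-thin xv))

  X-above : Fin n → Set
  X-above u = Σ (Fin n) λ e → X e × Between e u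

  X-above? : ∀ u → Dec (X-above u)
  X-above? u = any? (λ e → X? e ×-dec Between? e u)

  X-below : Fin n → Set
  X-below u = Σ (Fin n) λ v → X v × Between u v

  X-below? : ∀ u → Dec (X-below u)
  X-below? u = any? (λ v → X? v ×-dec Between? u v)

  -- The roles of a big kept vertex: special or on an uncut thin chain (T₀), on the part of a
  -- cut chain joined to the special vertex above (Upper) or below (Lower), or strictly
  -- between two cuts (Middle).
  InT₀ : Fin n → Set
  InT₀ u = Big u × Kept u × (special u ⊎ (thin u × ¬ X-above u × ¬ X-below u))

  Upper : Fin n → Set
  Upper u = Big u × Kept u × thin u × ¬ X-above u × X-below u

  Lower : Fin n → Set
  Lower u = Big u × Kept u × thin u × X-above u × ¬ X-below u

  Middle : Fin n → Set
  Middle u = Big u × Kept u × thin u × X-above u × X-below u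

  InT₀? : ∀ u → Dec (InT₀ u)
  InT₀? u = Big? u ×-dec (Kept? u ×-dec (special? u ⊎-dec (thin? u ×-dec (¬? (X-above? u) ×-dec ¬? (X-below? u)))))

  Upper? : ∀ u → Dec (Upper u)
  Upper? u = Big? u ×-dec (Kept? u ×-dec (thin? u ×-dec (¬? (X-above? u) ×-dec X-below? u)))

  Lower? : ∀ u → Dec (Lower u)
  Lower? u = Big? u ×-dec (Kept? u ×-dec (thin? u ×-dec (X-above? u ×-dec ¬? (X-below? u))))

  Middle? : ∀ u → Dec (Middle u)
  Middle? u = Big? u ×-dec (Kept? u ×-dec (thin? u ×-dec (X-above? u ×-dec X-below? u)))

  InT₀-Big : ∀ {u} → InT₀ u → Big u
  InT₀-Big = proj₁

  InT₀-Kept : ∀ {u} → InT₀ u → Kept u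
  InT₀-Kept t₀ = proj₁ (proj₂ t₀)

  special-InT₀ : ∀ {v} → special v → InT₀ v
  special-InT₀ sv = proj₁ sv , special-Kept sv , inj₁ sv

  Upper-thin : ∀ {u} → Upper u → thin u
  Upper-thin tr = proj₁ (proj₂ (proj₂ tr))

  Upper-¬X-above : ∀ {u} → Upper u → ¬ X-above u
  Upper-¬X-above tr = proj₁ (proj₂ (proj₂ (proj₂ tr)))

  Upper-X-below : ∀ {u} → Upper u → X-below u
  Upper-X-below tr = proj₂ (proj₂ (proj₂ (proj₂ tr)))

  Lower-thin : ∀ {u} → Lower u → thin u
  Lower-thin br = proj₁ (proj₂ (proj₂ br))

  Lower-X-above : ∀ {u} → Lower u → X-above u
  Lower-X-above br = proj₁ (proj₂ (proj₂ (proj₂ br)))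

  Lower-¬X-below : ∀ {u} → Lower u → ¬ X-below u
  Lower-¬X-below br = proj₂ (proj₂ (proj₂ (proj₂ br)))

  Middle-thin : ∀ {u} → Middle u → thin u
  Middle-thin mr = proj₁ (proj₂ (proj₂ mr))

  Middle-X-above : ∀ {u} → Middle u → X-above u
  Middle-X-above mr = proj₁ (proj₂ (proj₂ (proj₂ mr)))

  data Role (u : Fin n) : Set where
    role-T₀ : InT₀ u → Role u
    role-upper : Upper u → Role u
    role-lower : Lower u → Role u
    role-middle : Middle u → Role u

  role : ∀ u → Big u → Kept u → Role u
  role u bu ku with special? u
  ... | yes sp = role-T₀ (bu , ku , inj₁ sp)
  ... | no ns with X-above? u | X-below? u
  ... | no na  | no nb  = role-T₀ (bu , ku , inj₂ (¬special⇒thin bu ns , na , nb))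
  ... | no na  | yes eb = role-upper (bu , ku , ¬special⇒thin bu ns , na , eb)
  ... | yes ea | no nb  = role-lower (bu , ku , ¬special⇒thin bu ns , ea , nb)
  ... | yes ea | yes eb = role-middle (bu , ku , ¬special⇒thin bu ns , ea , eb)

  InT₀-¬Upper : ∀ {y} → InT₀ y → ¬ Upper y
  InT₀-¬Upper (_ , _ , inj₁ sp) tr = proj₂ sp (Upper-thin tr)
  InT₀-¬Upper (_ , _ , inj₂ (_ , _ , nb)) tr = nb (Upper-X-below tr)

  InT₀-¬Lower : ∀ {y} → InT₀ y → ¬ Lower y
  InT₀-¬Lower (_ , _ , inj₁ sp) br = proj₂ sp (Lower-thin br)
  InT₀-¬Lower (_ , _ , inj₂ (_ , na , _)) br = na (Lower-X-above br)

  InT₀-¬Middle : ∀ {y} → InT₀ y → ¬ Middle y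
  InT₀-¬Middle (_ , _ , inj₁ sp) mr = proj₂ sp (Middle-thin mr)
  InT₀-¬Middle (_ , _ , inj₂ (_ , na , _)) mr = na (Middle-X-above mr)

  Upper-¬Lower : ∀ {y} → Upper y → ¬ Lower y
  Upper-¬Lower tr br = Upper-¬X-above tr (Lower-X-above br)

  Upper-¬Middle : ∀ {y} → Upper y → ¬ Middle y
  Upper-¬Middle tr mr = Upper-¬X-above tr (Middle-X-above mr)

  Lower-¬Middle : ∀ {y} → Lower y → ¬ Middle y
  Lower-¬Middle br mr = Lower-¬X-below br (proj₂ (proj₂ (proj₂ (proj₂ mr))))

  X-above-par : ∀ {x} → x ≢ r → ¬ X (par x) → X-above x → X-above (par x)
  X-above-par {x} ne nx (e , xe , bt) = from (Between⇒′ bt)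
    where
    from : Between′ e x → X-above (par x)
    from H with Between′.h H in eh
    ... | zero = ⊥-elim (<⇒≱ (Between′.h≥1 H) (≤-reflexive eh))
    ... | suc zero = ⊥-elim (nx (subst X (trans (Between′.eq H) (cong (λ k → up k x) eh)) xe))
    ... | suc (suc k) = e , xe , Between′⇒ (proj₁ (Between′-split H 1 ≤-refl (subst (1 <_) (sym eh) (s≤s (s≤s z≤n)))))

  X-above-from-par : ∀ {x} → x ≢ r → thin (par x) → X-above (par x) → X-above x
  X-above-from-par {x} ne tp (e , xe , bt) = e , xe , Between′⇒ (Between′-trans (Between⇒′ bt) tp (Between′-par x ne))

  X-below-par : ∀ {x} → thin x → X-below x → X-below (par x)
  X-below-par {x} tx (v , xv , bt) = v , xv , Between′⇒ (Between′-trans (Between′-par x (thin≢r tx)) tx (Between⇒′ bt))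

  X-below-from-par : ∀ {x} → thin (par x) → Big x → x ≢ r → ¬ X x → X-below (par x) → X-below x
  X-below-from-par {x} tp bx ne nx (v , xv , bt) with Big-child-of-thin (Between⇒′ bt) (X-Big xv) tp (ne , refl , bx)
  ... | inj₁ refl = ⊥-elim (nx xv)
  ... | inj₂ (H , _) = v , xv , Between′⇒ H

  thin-over-special-¬X-below : ∀ {x} → special x → x ≢ r → thin (par x) → ¬ X-below (par x)
  thin-over-special-¬X-below sx ne tp (v , xv , bt) with Big-child-of-thin (Between⇒′ bt) (X-Big xv) tp (ne , refl , proj₁ sx)
  ... | inj₁ refl = proj₂ sx (X-thin xv)
  ... | inj₂ (_ , tx) = proj₂ sx tx

  thin-under-special-¬X-above : ∀ {x} → thin x → special (par x) → ¬ X-above x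
  thin-under-special-¬X-above {x} tx sp (e , xe , bt) = from (Between⇒′ bt)
    where
    from : Between′ e x → ⊥
    from H with Between′.h H in eh
    ... | zero = ⊥-elim (<⇒≱ (Between′.h≥1 H) (≤-reflexive eh))
    ... | suc zero = proj₂ sp (subst thin (trans (Between′.eq H) (cong (λ k → up k x) eh)) (X-thin xe))
    ... | suc (suc k) = proj₂ sp (Between′.ch H 1 ≤-refl (subst (1 <_) (sym eh) (s≤s (s≤s z≤n))))

  special-above : ∀ u → thin u → Σ (Fin n) λ v → special v × Between′ v u
  special-above u = go (dep u) u refl
    where
    go : ∀ f u → dep u ≡ f → thin u → Σ (Fin n) λ v → special v × Between′ v u
    go zero u e tu = ⊥-elim (thin≢r tu (dep≡0 u e))
    go (suc f) u e tu with special? (par u)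
    ... | yes sp = par u , sp , Between′-par u (thin≢r tu)
    ... | no nsp =
      let tp = ¬special⇒thin (Big-up (desc-par u) (thin⇒Big tu)) nsp
          (v , sv , H) = go f (par u) (suc-injective (trans (sym (par-dep u (thin≢r tu))) e)) tp
      in v , sv , Between′-trans H tp (Between′-par u (thin≢r tu))

  special-below : ∀ u → thin u → Σ (Fin n) λ v → special v × Between′ u v
  special-below u = go (size u) u ≤-refl
    where
    go : ∀ f u → size u ≤ f → thin u → Σ (Fin n) λ v → special v × Between′ u v
    go zero u le tu = ⊥-elim (<⇒≱ (size-pos u) le)
    go (suc f) u le tu with #bigChildren-pos u (subst (1 ≤_) (sym (thin-one-child tu)) ≤-refl)
    ... | c , c≢r , refl , bc with special? c
    ... | yes sc = c , sc , Between′-par c c≢r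
    ... | no nsc =
      let tc = ¬special⇒thin bc nsc
          (v , sv , H) = go f c (≤-pred (≤-trans (size-strict (desc-par c) (par≢ c c≢r)) le)) tc
      in v , sv , Between′-trans (Between′-par c c≢r) tc H

  TopOf : Fin n → Fin n → Set
  TopOf u v = special v × Between v u

  BotOf : Fin n → Fin n → Set
  BotOf u v = special v × Between u v

  -- the big vertex u belongs to the pendant tree S v
  AttachedTo : Fin n → Fin n → Set
  AttachedTo v u = u ≡ v ⊎ ((Upper u × TopOf u v) ⊎ (Lower u × BotOf u v))

  InS : Fin n → Fin n → Set
  InS v x = Kept x × (x ≡ v ⊎ (x ≢ v × AttachedTo v (att x)))

  InF : Fin n → Set
  InF x = Kept x × Middle (att x)

  T₀ : Graph n
  T₀ = Induced InT₀

  S : Fin n → Graph n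
  S v = Induced (InS v)

  F : Graph n
  F = Induced InF

  T₁ : Graph n
  T₁ = record { V = λ x → V T₀ x ⊎ ∃[ v ] (V T₀ v × V (S v) x)
              ; E = λ x y → E T₀ x y ⊎ ∃[ v ] (V T₀ v × E (S v) x y) }

  T₂ : Graph n
  T₂ = record { V = λ x → V T₁ x ⊎ V F x ; E = λ x y → E T₁ x y ⊎ E F x y }

  att≢⇒≢ : ∀ {x v} → Big v → att x ≢ v → x ≢ v
  att≢⇒≢ {x} bv ne refl = ne (att-Big x bv)

  Kept⇒T₂ : ∀ x → Kept x → V T₂ x
  Kept⇒T₂ x kx with role (att x) (Big-att x) (Kept-att x kx)
  ... | role-T₀ t₀ with x ≟F att x
  ... | yes e = inj₁ (inj₁ (subst InT₀ (sym e) t₀))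
  ... | no ne = inj₁ (inj₂ (att x , t₀ , kx , inj₂ (ne , inj₁ refl)))
  Kept⇒T₂ x kx | role-upper tr with special-above (att x) (Upper-thin tr)
  ... | v , sv , H = inj₁ (inj₂ (v , special-InT₀ sv , kx ,
                       inj₂ (att≢⇒≢ (proj₁ sv) (special≢thin (Upper-thin tr) sv) , inj₂ (inj₁ (tr , sv , Between′⇒ H)))))
  Kept⇒T₂ x kx | role-lower br with special-below (att x) (Lower-thin br)
  ... | v , sv , H = inj₁ (inj₂ (v , special-InT₀ sv , kx ,
                       inj₂ (att≢⇒≢ (proj₁ sv) (special≢thin (Lower-thin br) sv) , inj₂ (inj₂ (br , sv , Between′⇒ H)))))
  Kept⇒T₂ x kx | role-middle mr = inj₂ (kx , mr)

  T₂⇒Kept : ∀ {x} → V T₂ x → Kept x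
  T₂⇒Kept (inj₁ (inj₁ t₀)) = InT₀-Kept t₀
  T₂⇒Kept (inj₁ (inj₂ (v , _ , s))) = proj₁ s
  T₂⇒Kept (inj₂ f) = proj₁ f

  T₂-edge : ∀ {x y} → E T₂ x y → PE x y × Kept x × Kept y
  T₂-edge (inj₁ (inj₁ (pe , tx , ty))) = pe , InT₀-Kept tx , InT₀-Kept ty
  T₂-edge (inj₁ (inj₂ (v , _ , pe , sx , sy))) = pe , proj₁ sx , proj₁ sy
  T₂-edge (inj₂ (pe , fx , fy)) = pe , proj₁ fx , proj₁ fy

  module _ {x : Fin n} (x≢r : x ≢ r) where

    private
      p = par x

      pe : PE x p
      pe = inj₁ (x≢r , refl)

    T₀-edge : InT₀ x → InT₀ p → E T₂ x p
    T₀-edge tx tp = inj₁ (inj₁ (pe , tx , tp))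

    S-edge : ∀ v → InT₀ v → InS v x → InS v p → E T₂ x p
    S-edge v tv sx sp = inj₁ (inj₂ (v , tv , pe , sx , sp))

    F-edge : InF x → InF p → E T₂ x p
    F-edge fx fp = inj₂ (pe , fx , fp)

  Upper-InS : ∀ {y v} → Big y → Upper y → TopOf y v → y ≢ v → InS v y
  Upper-InS {y} by tr to ne = proj₁ (proj₂ tr) , inj₂ (ne , inj₂ (inj₁ (subst Upper (sym (att-Big y by)) tr , subst (λ z → TopOf z _) (sym (att-Big y by)) to)))

  Lower-InS : ∀ {y v} → Big y → Lower y → BotOf y v → y ≢ v → InS v y
  Lower-InS {y} by br bo ne = proj₁ (proj₂ br) , inj₂ (ne , inj₂ (inj₂ (subst Lower (sym (att-Big y by)) br , subst (λ z → BotOf z _) (sym (att-Big y by)) bo)))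

  -- A vertex outside the big subtree is in the same piece as its parent, which has the same attachment point.
  kept-edge-small : ∀ x → x ≢ r → ¬ Big x → Kept x → Kept (par x) → E T₂ x (par x)
  kept-edge-small x x≢r nbx kx kp = by-role (role (att x) (Big-att x) (Kept-att x kx))
    where
    p = par x
    ap : att x ≡ att p
    ap = att-par x nbx
    x≢ : ∀ {v} → Big v → x ≢ v
    x≢ bv refl = nbx bv
    p≢ : ∀ {v} → thin (att x) → special v → p ≢ v
    p≢ tx sv = att≢⇒≢ (proj₁ sv) (λ e → special≢thin tx sv (trans ap e))
    by-role : Role (att x) → E T₂ x p
    by-role (role-T₀ t₀) = S-edge x≢r (att x) t₀ (kx , inj₂ (x≢ (Big-att x) , inj₁ refl)) sp
      where
      sp : InS (att x) p
      sp with p ≟F att x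
      ... | yes e = kp , inj₁ e
      ... | no ne = kp , inj₂ (ne , inj₁ (sym ap))
    by-role (role-upper tr) with special-above (att x) (Upper-thin tr)
    ... | v , sv , H = S-edge x≢r v (special-InT₀ sv)
          (kx , inj₂ (x≢ (proj₁ sv) , inj₂ (inj₁ (tr , sv , Between′⇒ H))))
          (kp , inj₂ (p≢ (Upper-thin tr) sv , inj₂ (inj₁ (subst Upper ap tr , sv , subst (Between v) ap (Between′⇒ H)))))
    by-role (role-lower br) with special-below (att x) (Lower-thin br)
    ... | v , sv , H = S-edge x≢r v (special-InT₀ sv)
          (kx , inj₂ (x≢ (proj₁ sv) , inj₂ (inj₂ (br , sv , Between′⇒ H))))
          (kp , inj₂ (p≢ (Lower-thin br) sv , inj₂ (inj₂ (subst Lower ap br , sv , subst (λ z → Between z v) ap (Between′⇒ H)))))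
    by-role (role-middle mr) = F-edge x≢r (kx , mr) (kp , subst Middle ap mr)

  kept-edge-Big : ∀ x → x ≢ r → Big x → Kept x → Kept (par x) → E T₂ x (par x)
  kept-edge-Big x x≢r bx kx kp with special? x | special? p
    where p = par x
  ... | yes sx | yes sp = T₀-edge x≢r (special-InT₀ sx) (special-InT₀ sp)
  ... | yes sx | no nsp with X-above? (par x)
  ... | no na = T₀-edge x≢r (special-InT₀ sx) (bp , kp , inj₂ (tp , na , thin-over-special-¬X-below sx x≢r tp))
    where
    bp = Big-up (desc-par x) bx
    tp = ¬special⇒thin bp nsp
  ... | yes ea = S-edge x≢r x (special-InT₀ sx) (kx , inj₁ refl)
                   (Lower-InS bp (bp , kp , tp , ea , thin-over-special-¬X-below sx x≢r tp)
                     (sx , Between′⇒ (Between′-par x x≢r)) (par≢ x x≢r))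
    where
    bp = Big-up (desc-par x) bx
    tp = ¬special⇒thin bp nsp
  kept-edge-Big x x≢r bx kx kp | no nsx | yes sp with X-below? x
  ... | no nb = T₀-edge x≢r (bx , kx , inj₂ (tx , thin-under-special-¬X-above tx sp , nb)) (special-InT₀ sp)
    where tx = ¬special⇒thin bx nsx
  ... | yes eb = S-edge x≢r (par x) (special-InT₀ sp)
                   (Upper-InS bx (bx , kx , tx , thin-under-special-¬X-above tx sp , eb)
                     (sp , Between′⇒ (Between′-par x x≢r)) (λ e → par≢ x x≢r (sym e)))
                   (kp , inj₁ refl)
    where tx = ¬special⇒thin bx nsx
  kept-edge-Big x x≢r bx kx kp | no nsx | no nsp = both-thin (X-above? x) (X-below? x)
    where
    p = par x
    bp = Big-up (desc-par x) bx
    tx = ¬special⇒thin bx nsx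
    tp = ¬special⇒thin bp nsp
    ¬X-above-p : ¬ X-above x → ¬ X-above p
    ¬X-above-p na ea = na (X-above-from-par x≢r tp ea)
    ¬X-below-p : ¬ X-below x → ¬ X-below p
    ¬X-below-p nb eb = nb (X-below-from-par tp bx x≢r (Kept⇒¬X bx kx) eb)
    both-thin : Dec (X-above x) → Dec (X-below x) → E T₂ x p
    both-thin (no na) (no nb) = T₀-edge x≢r (bx , kx , inj₂ (tx , na , nb)) (bp , kp , inj₂ (tp , ¬X-above-p na , ¬X-below-p nb))
    both-thin (no na) (yes eb) =
      let v , sv , H = special-above p tp in
      S-edge x≢r v (special-InT₀ sv)
        (Upper-InS bx (bx , kx , tx , na , eb) (sv , Between′⇒ (Between′-trans H tp (Between′-par x x≢r))) (special≢thin tx sv))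
        (Upper-InS bp (bp , kp , tp , ¬X-above-p na , X-below-par tx eb) (sv , Between′⇒ H) (special≢thin tp sv))
    both-thin (yes ea) (no nb) =
      let v , sv , H = special-below x tx in
      S-edge x≢r v (special-InT₀ sv)
        (Lower-InS bx (bx , kx , tx , ea , nb) (sv , Between′⇒ H) (special≢thin tx sv))
        (Lower-InS bp (bp , kp , tp , X-above-par x≢r (Kept⇒¬X bp kp) ea , ¬X-below-p nb)
          (sv , Between′⇒ (Between′-trans (Between′-par x x≢r) tx H)) (special≢thin tp sv))
    both-thin (yes ea) (yes eb) =
      F-edge x≢r (kx , subst Middle (sym (att-Big x bx)) (bx , kx , tx , ea , eb))
        (kp , subst Middle (sym (att-Big p bp)) (bp , kp , tp , X-above-par x≢r (Kept⇒¬X bp kp) ea , X-below-par tx eb))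

  kept-edge : ∀ x → x ≢ r → Kept x → Kept (par x) → E T₂ x (par x)
  kept-edge x x≢r kx kp with Big? x
  ... | yes bx = kept-edge-Big x x≢r bx kx kp
  ... | no nbx = kept-edge-small x x≢r nbx kx kp

module PendantTrees {n : ℕ} (T : Graph n) (isG : IsGraph T) (allV : ∀ x → V T x) (R : Rooted T)
                    (W : ℕ) (W≤n : W ≤ n) (q₁ J j : ℕ) (q₁≥1 : 1 ≤ q₁) (j≤J : j ≤ J) where

  open Roles T isG allV R W W≤n q₁ J j q₁≥1 j≤J public

  S∩T₀ : ∀ {v u} → InS v u → InT₀ u → u ≡ v
  S∩T₀ (_ , inj₁ e) _ = e
  S∩T₀ {v} {u} (_ , inj₂ (_ , inj₁ e)) t₀ = trans (sym (att-Big u (InT₀-Big t₀))) e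
  S∩T₀ {v} {u} (_ , inj₂ (_ , inj₂ (inj₁ (tr , _)))) t₀ = ⊥-elim (InT₀-¬Upper t₀ (subst Upper (att-Big u (InT₀-Big t₀)) tr))
  S∩T₀ {v} {u} (_ , inj₂ (_ , inj₂ (inj₂ (br , _)))) t₀ = ⊥-elim (InT₀-¬Lower t₀ (subst Lower (att-Big u (InT₀-Big t₀)) br))

  AttachedTo-unique : ∀ {v w u} → InT₀ v → InT₀ w → AttachedTo v u → AttachedTo w u → v ≡ w
  AttachedTo-unique tv tw (inj₁ e) (inj₁ e') = trans (sym e) e'
  AttachedTo-unique tv tw (inj₁ refl) (inj₂ (inj₁ (tr , _))) = ⊥-elim (InT₀-¬Upper tv tr)
  AttachedTo-unique tv tw (inj₁ refl) (inj₂ (inj₂ (br , _))) = ⊥-elim (InT₀-¬Lower tv br)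
  AttachedTo-unique tv tw (inj₂ (inj₁ (tr , _))) (inj₁ refl) = ⊥-elim (InT₀-¬Upper tw tr)
  AttachedTo-unique tv tw (inj₂ (inj₂ (br , _))) (inj₁ refl) = ⊥-elim (InT₀-¬Lower tw br)
  AttachedTo-unique tv tw (inj₂ (inj₁ (tr , sv , bv))) (inj₂ (inj₁ (_ , sw , bw))) =
    special-above-unique sv sw (Between⇒′ bv) (Between⇒′ bw)
  AttachedTo-unique tv tw (inj₂ (inj₁ (tr , _))) (inj₂ (inj₂ (br , _))) = ⊥-elim (Upper-¬Lower tr br)
  AttachedTo-unique tv tw (inj₂ (inj₂ (br , _))) (inj₂ (inj₁ (tr , _))) = ⊥-elim (Upper-¬Lower tr br)
  AttachedTo-unique tv tw (inj₂ (inj₂ (br , sv , bv))) (inj₂ (inj₂ (_ , sw , bw))) =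
    special-below-unique (Lower-thin br) sv sw (Between⇒′ bv) (Between⇒′ bw)

  S-disjoint : ∀ {v w} → InT₀ v → InT₀ w → v ≢ w → ∀ u → InS v u → ¬ InS w u
  S-disjoint tv tw ne u (_ , inj₁ refl) sw = ne (S∩T₀ sw tv)
  S-disjoint tv tw ne u sv (_ , inj₁ refl) = ne (sym (S∩T₀ sv tw))
  S-disjoint tv tw ne u (_ , inj₂ (_ , av)) (_ , inj₂ (_ , aw)) = ne (AttachedTo-unique tv tw av aw)

  -- Every vertex of S v reaches v inside S v: first up to its attachment point, then along
  -- the thin chain to v.
  module _ (v : Fin n) (tv : InT₀ v) where

    private
      S-isGraph : IsGraph (S v)
      S-isGraph = Induced-isGraph (InS v)

      v∈S : InS v v
      v∈S = InT₀-Kept tv , inj₁ refl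

    S-par-edge : ∀ {x} → x ≢ r → InS v x → InS v (par x) → E (S v) x (par x)
    S-par-edge ne sx sp = inj₁ (ne , refl) , sx , sp

    InS-attached : ∀ {y} → InS v y → y ≢ v → AttachedTo v (att y)
    InS-attached (_ , inj₁ e) ne = ⊥-elim (ne e)
    InS-attached (_ , inj₂ (_ , a)) ne = a

    InS-Big : ∀ {u} → Big u → Kept u → u ≢ v → (Upper u × TopOf u v) ⊎ (Lower u × BotOf u v) → InS v u
    InS-Big {u} bu ku ne d = ku , inj₂ (ne , inj₂ (subst (λ z → (Upper z × TopOf z v) ⊎ (Lower z × BotOf z v)) (sym (att-Big u bu)) d))

    reach-att : ∀ y → InS v y → Reach (S v) y (att y)
    reach-att y = go (dep y) y refl
      where
      go : ∀ f y → dep y ≡ f → InS v y → Reach (S v) y (att y)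
      go f y e sy with Big? y
      ... | yes by = subst (Reach (S v) y) (sym (att-Big y by)) (here sy)
      go zero y e sy | no nby = ⊥-elim (nby (subst Big (sym (dep≡0 y e)) Big-r))
      go (suc f) y e sy | no nby =
        step (S-par-edge ne sy sp) (subst (Reach (S v) (par y)) (sym ap) (go f (par y) (suc-injective (trans (sym (par-dep y ne)) e)) sp))
        where
        ne = ¬Big⇒≢r nby
        ap = att-par y nby
        attached : AttachedTo v (att y)
        attached = InS-attached sy (λ { refl → nby (InT₀-Big tv) })
        sp : InS v (par y)
        sp with par y ≟F v
        ... | yes e′ = subst (λ z → ¬ X z) ap (proj₁ sy) , inj₁ e′
        ... | no ne′ = subst (λ z → ¬ X z) ap (proj₁ sy) , inj₂ (ne′ , subst (AttachedTo v) ap attached)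

    reach-from-Upper : ∀ f u → (H : Between′ v u) → Between′.h H ≡ f → Upper u → special v → Reach (S v) u v
    reach-from-Upper zero u H e tr sv = ⊥-elim (<⇒≱ (Between′.h≥1 H) (≤-reflexive e))
    reach-from-Upper (suc zero) u H e tr sv =
      step (S-par-edge (thin≢r tu) (InS-Big (proj₁ tr) (proj₁ (proj₂ tr)) (special≢thin tu sv) (inj₁ (tr , sv , Between′⇒ H))) (subst (InS v) pv v∈S))
           (subst (λ z → Reach (S v) z v) pv (here v∈S))
      where
      tu = Upper-thin tr
      pv : v ≡ par u
      pv = trans (Between′.eq H) (cong (λ k → up k u) e)
    reach-from-Upper (suc (suc f)) u H e tr sv =
      step (S-par-edge (thin≢r tu) (InS-Big (proj₁ tr) (proj₁ (proj₂ tr)) (special≢thin tu sv) (inj₁ (tr , sv , Between′⇒ H)))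
                                   (InS-Big bp kp (special≢thin tp sv) (inj₁ (trp , sv , Between′⇒ Hp))))
           (reach-from-Upper (suc f) (par u) Hp (cong (_∸ 1) e) trp sv)
      where
      tu = Upper-thin tr
      split = Between′-split H 1 ≤-refl (subst (1 <_) (sym e) (s≤s (s≤s z≤n)))
      Hp : Between′ v (par u)
      Hp = proj₁ split
      tp : thin (par u)
      tp = proj₂ (proj₂ split)
      bp = thin⇒Big tp
      kp : Kept (par u)
      kp = ¬X⇒Kept bp (λ xp → Upper-¬X-above tr (par u , xp , Between′⇒ (Between′-par u (thin≢r tu))))
      trp : Upper (par u)
      trp = bp , kp , tp , (λ ea → Upper-¬X-above tr (X-above-from-par (thin≢r tu) tp ea)) , X-below-par tu (Upper-X-below tr)

    Lower-chain-InS : ∀ {u} → (H : Between′ u v) → Lower u → special v → ∀ i → i ≤ Between′.h H → InS v (up i v)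
    Lower-chain-InS H br sv zero _ = v∈S
    Lower-chain-InS {u} H br sv (suc i) le with m≤n⇒m<n∨m≡n le
    ... | inj₂ eq = subst (InS v) (trans (Between′.eq H) (cong (λ z → up z v) (sym eq)))
                      (InS-Big (proj₁ br) (proj₁ (proj₂ br)) (special≢thin (Lower-thin br) sv) (inj₂ (br , sv , Between′⇒ H)))
    ... | inj₁ lt = InS-Big by ky (special≢thin ty sv) (inj₂ (bry , sv , Between′⇒ H₂))
      where
      spl = Between′-split H (suc i) (s≤s z≤n) lt
      H₁ = proj₁ spl
      H₂ = proj₁ (proj₂ spl)
      ty = proj₂ (proj₂ spl)
      by = thin⇒Big ty
      y = up (suc i) v
      ky : Kept y
      ky = ¬X⇒Kept by (λ xy → Lower-¬X-below br (y , xy , Between′⇒ H₁))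
      ea : X-above y
      ea with Lower-X-above br
      ... | e , xe , bte = e , xe , Between′⇒ (Between′-trans (Between⇒′ bte) (Lower-thin br) H₁)
      bry : Lower y
      bry = by , ky , ty , ea , λ (v' , xv' , bt') → Lower-¬X-below br (v' , xv' , Between′⇒ (Between′-trans H₁ ty (Between⇒′ bt')))

    reach-up-Lower : ∀ {u} → (H : Between′ u v) → Lower u → special v → ∀ k → k ≤ Between′.h H → Reach (S v) v (up k v)
    reach-up-Lower H br sv zero le = here v∈S
    reach-up-Lower H br sv (suc k) le =
      reach-++ S-isGraph (reach-up-Lower H br sv k (≤-trans (n≤1+n k) le))
        (step (subst (E (S v) (up k v)) (sym (up-suc k v))
                 (S-par-edge up-k≢r (Lower-chain-InS H br sv k (≤-trans (n≤1+n k) le)) (subst (InS v) (up-suc k v) in-S)))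
              (here in-S))
      where
      in-S = Lower-chain-InS H br sv (suc k) le
      up-k≢r : up k v ≢ r
      up-k≢r e = thin≢r (Between′-thin-top H (Lower-thin br) (suc k) (s≤s z≤n) le) (trans (up-suc k v) (trans (cong par e) par-r))

    reach-v : ∀ x → InS v x → Reach (S v) x v
    reach-v x (kx , inj₁ refl) = here (kx , inj₁ refl)
    reach-v x sx@(kx , inj₂ (ne , d)) = reach-++ S-isGraph (reach-att x sx) (from d)
      where
      from : AttachedTo v (att x) → Reach (S v) (att x) v
      from (inj₁ e) = subst (λ z → Reach (S v) z v) (sym e) (here v∈S)
      from (inj₂ (inj₁ (tr , sv , bt))) = reach-from-Upper _ (att x) (Between⇒′ bt) refl tr sv
      from (inj₂ (inj₂ (br , sv , bt))) = reach-rev S-isGraph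
        (subst (Reach (S v) v) (sym (Between′.eq (Between⇒′ bt))) (reach-up-Lower (Between⇒′ bt) br sv _ ≤-refl))

    S-tree : ¬ Cycle T → IsTree (S v)
    S-tree acyclic = Induced-forest acyclic (InS v) , connected-via S-isGraph v v∈S reach-v , v , v∈S

module ComponentBounds {n : ℕ} (T : Graph n) (isG : IsGraph T) (allV : ∀ x → V T x) (R : Rooted T)
                       (W : ℕ) (W≤n : W ≤ n) (q₁ J j : ℕ) (q₁≥1 : 1 ≤ q₁) (j≤J : j ≤ J) where

  open PendantTrees T isG allV R W W≤n q₁ J j q₁≥1 j≤J public

  L : ℕ
  L = P + q₁

  P<L : P < L
  P<L = m<m+n P q₁≥1

  long-thin-chain-X : ∀ x → Big x → ∀ h → L ≤ h → ThinAbove h x → Σ ℕ λ i → 1 ≤ i × i ≤ P × X (up i x)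
  long-thin-chain-X x bx h L≤h ch with long-chain-StripStart x bx (λ i p q → ch i p (<-≤-trans q L≤h))
  ... | i₀ , i₀<P , st = suc i₀ , s≤s z≤n , i₀<P , (up i₀ x , st , 0 , q₁≥1 , up-suc≡ )
    where
    up-suc≡ : up (suc i₀) x ≡ up 1 (up i₀ x)
    up-suc≡ = trans (cong (λ k → up k x) (+-comm 1 i₀)) (up-+ i₀ 1 x)

  long-Between′-X : ∀ {a c} (H : Between′ a c) → Big c → L ≤ Between′.h H →
                    Σ ℕ λ i → X (up i c) × Between′ a (up i c) × Between′ (up i c) c
  long-Between′-X H bc L≤h with long-thin-chain-X _ bc (Between′.h H) L≤h (Between′.ch H)
  ... | i , i≥1 , i≤P , xi = i , xi , proj₁ split , proj₁ (proj₂ split)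
    where split = Between′-split H i i≥1 (<-≤-trans (≤-<-trans i≤P P<L) L≤h)

  ¬X-above⇒short : ∀ {a c} → ¬ X-above c → Big c → (H : Between′ a c) → Between′.h H < L
  ¬X-above⇒short na bc H with Between′.h H <? L
  ... | yes p = p
  ... | no np with long-Between′-X H bc (≮⇒≥ np)
  ... | i , xi , _ , lower = ⊥-elim (na (_ , xi , Between′⇒ lower))

  ¬X-below⇒short : ∀ {a c} → ¬ X-below a → Big c → (H : Between′ a c) → Between′.h H < L
  ¬X-below⇒short nb bc H with Between′.h H <? L
  ... | yes p = p
  ... | no np with long-Between′-X H bc (≮⇒≥ np)
  ... | i , xi , upper , _ = ⊥-elim (nb (_ , xi , Between′⇒ upper))

  mod-L-injective : ∀ {k k'} → k < L → k' < L → k mod L ≡ k' mod L → k ≡ k'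
  mod-L-injective {k} {k'} k<L k'<L e = begin
    k           ≡⟨ m<n⇒m%n≡m k<L ⟨
    k % L       ≡⟨ toℕ-fromℕ< (m%n<n k L) ⟨
    toℕ (k mod L)   ≡⟨ cong toℕ e ⟩
    toℕ (k' mod L)  ≡⟨ toℕ-fromℕ< (m%n<n k' L) ⟩
    k' % L      ≡⟨ m<n⇒m%n≡m k'<L ⟩
    k'          ∎
    where open ≡-Reasoning

  -- Each thin vertex carries fewer than W attached vertices.
  ∑-att-thin : ∀ {N} (Q : Fin n → Set) (Q? : ∀ u → Dec (Q u)) → (∀ u → Q u → thin u) → (g : Fin n → Fin N) →
               (∀ u u' → Q u → Q u' → g u ≡ g u' → u ≡ u') → ∑ (λ y → 𝟙 (Q? (att y))) ≤ W * N
  ∑-att-thin {N} Q Q? Q⇒thin g inj = begin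
      ∑ (λ y → 𝟙 (Q? (att y)))
    ≡⟨ trans (∑-fibres att (λ u → 𝟙 (Q? u))) (∑-cong (λ u → cong (𝟙 (Q? u) *_) (sym (weight-def u)))) ⟩
      ∑ (λ u → 𝟙 (Q? u) * weight u)
    ≤⟨ ∑-mono pointwise ⟩
      ∑ (λ u → W * 𝟙 (Q? u))
    ≡⟨ ∑-*ˡ W (λ u → 𝟙 (Q? u)) ⟩
      W * ∑ (λ u → 𝟙 (Q? u))
    ≤⟨ *-monoʳ-≤ W (∑-≤-injection (λ u → 𝟙 (Q? u)) g (λ u → 𝟙≤1 (Q? u)) (λ u u' p q → inj u u' (𝟙-pos (Q? u) p) (𝟙-pos (Q? u') q))) ⟩
      W * N
    ∎
    where
    open ≤-Reasoning
    pointwise : ∀ u → 𝟙 (Q? u) * weight u ≤ W * 𝟙 (Q? u)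
    pointwise u with Q? u
    ... | yes q = subst₂ _≤_ (sym (+-identityʳ (weight u))) (sym (*-identityʳ W)) (<⇒≤ (thin-light (Q⇒thin u q)))
    ... | no _ = z≤n

  AtMost-via-∑ : {Q : Fin n → Set} (g : Fin n → ℕ) (m : ℕ) → (∀ y → Q y → 1 ≤ g y) → ∑ g ≤ m → AtMost Q m
  AtMost-via-∑ g m Q⇒pos ∑≤m xs u all = ≤-trans (length≤∑ xs u all g Q⇒pos) ∑≤m

  AtMost-via-att : {Q : Fin n → Set} (A : Fin n → Set) (A? : ∀ u → Dec (A u)) (m : ℕ) → (∀ y → Q y → A (att y)) →
                   ∑ (λ y → 𝟙 (A? (att y))) ≤ m → AtMost Q m
  AtMost-via-att A A? m Q⇒A = AtMost-via-∑ (λ y → 𝟙 (A? (att y))) m (λ y q → ≤-reflexive (sym (𝟙-yes (A? (att y)) (Q⇒A y q))))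

  -- Components of S v - v: a component below v stays inside the subtree of one child c of v,
  -- and consists of the vertices attached to the Upper chain running down from v through c;
  -- a component above v consists of the vertices attached to the Lower chain above v.
  -- These chains are shorter than L, and each of their vertices carries fewer than W vertices.
  module _ (v : Fin n) (tv : InT₀ v) where

    private
      D : Graph n
      D = deleteV (S v) v

      D-isGraph : IsGraph D
      D-isGraph = record { ends = λ ((pe , sx , sy) , xv , yv) → (sx , xv) , (sy , yv)
                         ; sym = λ ((pe , sx , sy) , xv , yv) → (PE-sym pe , sy , sx) , yv , xv
                         ; loopless = λ ((pe , _) , _) → PE-irrefl pe }

      StrictDesc : Fin n → Set
      StrictDesc y = desc v y × y ≢ v

      branch : (y : Fin n) → Dec (desc v y) → Dec (y ≡ v) → Fin n
      branch y (yes _) (no _) = child-towards v y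
      branch y (yes _) (yes _) = v
      branch y (no _) _ = v

      piece : Fin n → Fin n
      piece y = branch y (desc? v y) (y ≟F v)

      piece-strict : ∀ y → StrictDesc y → piece y ≡ child-towards v y
      piece-strict y (d , ne) = from (desc? v y) (y ≟F v)
        where
        from : (dy : Dec (desc v y)) (ey : Dec (y ≡ v)) → branch y dy ey ≡ child-towards v y
        from (yes _) (no _) = refl
        from (yes _) (yes e) = ⊥-elim (ne e)
        from (no nd) _ = ⊥-elim (nd d)

      piece-¬strict : ∀ y → ¬ StrictDesc y → piece y ≡ v
      piece-¬strict y nn = from (desc? v y) (y ≟F v)
        where
        from : (dy : Dec (desc v y)) (ey : Dec (y ≡ v)) → branch y dy ey ≡ v
        from (yes d) (no ne) = ⊥-elim (nn (d , ne))
        from (yes _) (yes _) = refl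
        from (no _) _ = refl

      child-towards-par : ∀ x → x ≢ r → desc v (par x) → par x ≢ v → child-towards v x ≡ child-towards v (par x)
      child-towards-par x x≢r dp pv = cong (λ k → up k x) index
        where
        p = par x
        v<p : dep v < dep p
        v<p = ≤∧≢⇒< (desc-dep dp) (λ e → pv (sym (desc-eq dp e)))
        index : dep x ∸ dep v ∸ 1 ≡ suc (dep p ∸ dep v ∸ 1)
        index = begin
            dep x ∸ dep v ∸ 1         ≡⟨ cong (λ z → z ∸ dep v ∸ 1) (par-dep x x≢r) ⟩
            suc (dep p) ∸ dep v ∸ 1   ≡⟨ cong (_∸ 1) (+-∸-assoc 1 (<⇒≤ v<p)) ⟩
            dep p ∸ dep v             ≡⟨ suc-pred (dep p ∸ dep v) {{>-nonZero (m<n⇒0<n∸m v<p)}} ⟨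
            suc (dep p ∸ dep v ∸ 1)   ∎
          where open ≡-Reasoning

      piece-par : ∀ x → x ≢ r → x ≢ v → par x ≢ v → piece x ≡ piece (par x)
      piece-par x x≢r xv pv = by-cases (desc? v (par x))
        where
        by-cases : Dec (desc v (par x)) → piece x ≡ piece (par x)
        by-cases (yes dp) = trans (piece-strict x (desc-from-par dp , xv))
                              (trans (child-towards-par x x≢r dp pv) (sym (piece-strict (par x) (dp , pv))))
        by-cases (no ndp) = trans (piece-¬strict x (λ (d , _) → ndp (desc-to-par d xv)))
                              (sym (piece-¬strict (par x) (λ (d , _) → ndp d)))

      reach-piece : ∀ {y₀ y} → Reach D y₀ y → piece y₀ ≡ piece y
      reach-piece (here _) = refl
      reach-piece (step ((inj₁ (xr , refl) , _ , _) , xv , zv) w) = trans (piece-par _ xr xv zv) (reach-piece w)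
      reach-piece (step ((inj₂ (zr , refl) , _ , _) , xv , zv) w) = trans (sym (piece-par _ zr zv xv)) (reach-piece w)

      piece≡v⇒¬strict : ∀ {y} → piece y ≡ v → ¬ StrictDesc y
      piece≡v⇒¬strict {y} e (d , ne) = 1+n≢n (trans (sym (dep-child-towards d ne)) (cong dep (trans (sym (piece-strict y (d , ne))) e)))

      reach-below : ∀ {y₀ y} → Reach D y₀ y → StrictDesc y₀ → StrictDesc y × child-towards v y ≡ child-towards v y₀
      reach-below {y₀} {y} w sd₀ with desc? v y | y ≟F v
      ... | yes d | no ne = (d , ne) , trans (sym (piece-strict y (d , ne))) (trans (sym (reach-piece w)) (piece-strict y₀ sd₀))
      ... | yes d | yes e = ⊥-elim (piece≡v⇒¬strict (trans (reach-piece w) (piece-¬strict y (λ (_ , ne) → ne e))) sd₀)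
      ... | no nd | _ = ⊥-elim (piece≡v⇒¬strict (trans (reach-piece w) (piece-¬strict y (λ (d , _) → nd d))) sd₀)

      reach-not-below : ∀ {y₀ y} → Reach D y₀ y → ¬ StrictDesc y₀ → ¬ StrictDesc y
      reach-not-below {y₀} {y} w nsd₀ sd = piece≡v⇒¬strict (trans (sym (reach-piece w)) (piece-¬strict y₀ nsd₀)) sd

      reach-attached : ∀ {y₀ y} → Reach D y₀ y → AttachedTo v (att y)
      reach-attached w = let (sy , y≢v) = reach-end D-isGraph w in InS-attached v tv sy y≢v

    below-component-small : ∀ m → W * L ≤ m → ∀ y₀ → StrictDesc y₀ → AtMost (Reach D y₀) m
    below-component-small m WL≤m y₀ sd₀ with Big? (child-towards v y₀)
    ... | no nbc = AtMost-via-∑ (λ y → 𝟙 (desc? c y)) m (λ y w → ≤-reflexive (sym (𝟙-yes (desc? c y) (desc-c w))))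
                     (≤-trans (≤-reflexive (sym (size-def c))) (≤-trans (<⇒≤ (≰⇒> nbc)) (≤-trans (m≤m*n W L) WL≤m)))
      where
      c = child-towards v y₀
      desc-c : ∀ {y} → Reach D y₀ y → desc c y
      desc-c w = let ((d , ne) , same) = reach-below w sd₀ in subst (λ z → desc z _) same (desc-child-towards d ne)
    ... | yes bc = AtMost-via-att Q Q? m (λ y w → Q-att w) (≤-trans (∑-att-thin Q Q? (λ u q → Upper-thin (proj₁ q)) (λ u → (dep u ∸ dep v) mod L) inj) WL≤m)
      where
      c = child-towards v y₀
      dep-c : dep c ≡ suc (dep v)
      dep-c = dep-child-towards (proj₁ sd₀) (proj₂ sd₀)
      Q : Fin n → Set
      Q u = Upper u × Between v u × desc c u
      Q? : ∀ u → Dec (Q u)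
      Q? u = Upper? u ×-dec (Between? v u ×-dec desc? c u)
      Q-att : ∀ {y} → Reach D y₀ y → Q (att y)
      Q-att {y} w with reach-below w sd₀ | reach-attached w
      ... | (d , ne) , same | att-y = by-attachment att-y
        where
        c-att : desc c (att y)
        c-att = att-lowest y (subst (λ z → desc z y) same (desc-child-towards d ne)) bc
        v<c : dep v < dep c
        v<c = subst (dep v <_) (sym dep-c) ≤-refl
        by-attachment : AttachedTo v (att y) → Q (att y)
        by-attachment (inj₁ e) = ⊥-elim (<⇒≱ v<c (subst (λ z → dep c ≤ dep z) e (desc-dep c-att)))
        by-attachment (inj₂ (inj₁ (tr , _ , bt))) = tr , bt , c-att
        by-attachment (inj₂ (inj₂ (_ , _ , bt))) =
          ⊥-elim (<⇒≱ (≤-trans (m∸n≢0⇒n<m (λ e → <⇒≱ (proj₁ bt) (≤-reflexive e))) (<⇒≤ v<c)) (desc-dep c-att))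
      up-to-c : ∀ z → desc c z → up (dep z ∸ dep v ∸ 1) z ≡ c
      up-to-c z dz = trans (cong (λ k → up k z) (trans (pred[m∸n]≡m∸[1+n] (dep z) (dep v)) (cong (dep z ∸_) (sym dep-c)))) dz
      inj : ∀ u u' → Q u → Q u' → (dep u ∸ dep v) mod L ≡ (dep u' ∸ dep v) mod L → u ≡ u'
      inj u u' (tr , bt , du) (tr' , bt' , du') e =
        Big-below-thin-unique (h ∸ 1) u u' (proj₁ tr) (proj₁ tr')
          (trans (up-to-c u du) (sym (trans (cong (λ k → up (k ∸ 1) u') h≡h') (up-to-c u' du'))))
          (λ i p q → Between′.ch H i p (subst (suc i ≤_) (suc-pred h {{>-nonZero (Between′.h≥1 H)}}) (s≤s q)))
        where
        H = Between⇒′ bt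
        H' = Between⇒′ bt'
        h = Between′.h H
        h≡h' : h ≡ Between′.h H'
        h≡h' = mod-L-injective (¬X-above⇒short (Upper-¬X-above tr) (proj₁ tr) H) (¬X-above⇒short (Upper-¬X-above tr') (proj₁ tr') H') e

    above-component-small : ∀ m → W * L ≤ m → ∀ y₀ → ¬ StrictDesc y₀ → AtMost (Reach D y₀) m
    above-component-small m WL≤m y₀ nsd₀ =
      AtMost-via-att Q Q? m (λ y w → Q-att w) (≤-trans (∑-att-thin Q Q? (λ u q → Lower-thin (proj₁ q)) (λ u → (dep v ∸ dep u) mod L) inj) WL≤m)
      where
      Q : Fin n → Set
      Q u = Lower u × Between u v
      Q? : ∀ u → Dec (Q u)
      Q? u = Lower? u ×-dec Between? u v
      Q-att : ∀ {y} → Reach D y₀ y → Q (att y)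
      Q-att {y} w = by-attachment (reach-attached w)
        where
        y≢v = proj₂ (reach-end D-isGraph w)
        by-attachment : AttachedTo v (att y) → Q (att y)
        by-attachment (inj₁ e) = ⊥-elim (reach-not-below w nsd₀ (subst (λ z → desc z y) e (desc-att y) , y≢v))
        by-attachment (inj₂ (inj₁ (_ , _ , bt))) =
          ⊥-elim (reach-not-below w nsd₀ (desc-trans (subst (λ z → desc z (att y)) (sym (Between′.eq H)) (desc-up (Between′.h H) (att y))) (desc-att y) , y≢v))
          where H = Between⇒′ bt
        by-attachment (inj₂ (inj₂ (br , _ , bt))) = br , bt
      inj : ∀ u u' → Q u → Q u' → (dep v ∸ dep u) mod L ≡ (dep v ∸ dep u') mod L → u ≡ u'
      inj u u' (br , bt) (br' , bt') e = trans (Between′.eq H) (trans (cong (λ k → up k v) h≡h') (sym (Between′.eq H')))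
        where
        H = Between⇒′ bt
        H' = Between⇒′ bt'
        h≡h' : Between′.h H ≡ Between′.h H'
        h≡h' = mod-L-injective (¬X-below⇒short (Lower-¬X-below br) (InT₀-Big tv) H) (¬X-below⇒short (Lower-¬X-below br') (InT₀-Big tv) H') e

    S-components-small : ∀ m → W * L ≤ m → SmallComponents (deleteV (S v) v) m
    S-components-small m WL≤m y₀ _ with desc? v y₀ | y₀ ≟F v
    ... | yes d | no ne = below-component-small m WL≤m y₀ (d , ne)
    ... | yes _ | yes e = above-component-small m WL≤m y₀ (λ (_ , ne) → ne e)
    ... | no nd | _ = above-component-small m WL≤m y₀ (λ (d , _) → nd d)

  -- nearest strict ancestor in X (junk value when there is none)
  nearest-X : Fin n → Fin n
  nearest-X x = go (dep x) x
    where
    go : ℕ → Fin n → Fin n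
    go zero x = x
    go (suc f) x with X? (par x)
    ... | yes _ = par x
    ... | no _ = go f (par x)

  nearest-X-par : ∀ x → x ≢ r → ¬ X (par x) → nearest-X x ≡ nearest-X (par x)
  nearest-X-par x ne nx with dep x | par-dep x ne
  ... | .(suc (dep (par x))) | refl with X? (par x)
  ... | yes xp = ⊥-elim (nx xp)
  ... | no _ = refl

  nearest-X-par-X : ∀ x → x ≢ r → X (par x) → nearest-X x ≡ par x
  nearest-X-par-X x ne xp with dep x | par-dep x ne
  ... | .(suc (dep (par x))) | refl with X? (par x)
  ... | yes _ = refl
  ... | no nx = ⊥-elim (nx xp)

  record NearestX (u : Fin n) (bound : ℕ) : Set where
    field
      h : ℕ
      h≥1 : 1 ≤ h
      h≤ : h ≤ bound
      eq : nearest-X u ≡ up h u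
      X-at : X (up h u)
      minimal : ∀ i → 1 ≤ i → i < h → ¬ X (up i u)

  nearest-X-spec : ∀ u b → 1 ≤ b → b ≤ dep u → X (up b u) → NearestX u b
  nearest-X-spec u b = go (dep u) u refl b
    where
    go : ∀ f u → dep u ≡ f → ∀ b → 1 ≤ b → b ≤ dep u → X (up b u) → NearestX u b
    go zero u e b p q xb = ⊥-elim (<⇒≱ p (subst (b ≤_) e q))
    go (suc f) u e b p q xb with X? (par u)
    ... | yes xp = record { h = 1 ; h≥1 = ≤-refl ; h≤ = p ; eq = nearest-X-par-X u u≢r xp ; X-at = xp
                          ; minimal = λ i i≥1 i<1 → ⊥-elim (<⇒≱ i<1 i≥1) }
      where
      u≢r : u ≢ r
      u≢r eq = <⇒≱ p (subst (b ≤_) (trans (cong dep eq) dep-r) q)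
    ... | no nxp with b
    ... | zero = ⊥-elim (<⇒≱ p ≤-refl)
    ... | suc zero = ⊥-elim (nxp xb)
    ... | suc (suc b') = record { h = suc (NearestX.h N) ; h≥1 = s≤s z≤n ; h≤ = s≤s (NearestX.h≤ N)
                                ; eq = trans (nearest-X-par u u≢r nxp) (NearestX.eq N) ; X-at = NearestX.X-at N ; minimal = minimal }
      where
      u≢r : u ≢ r
      u≢r eq = <⇒≱ p (subst (suc (suc b') ≤_) (trans (cong dep eq) dep-r) q)
      N : NearestX (par u) (suc b')
      N = go f (par u) (suc-injective (trans (sym (par-dep u u≢r)) e)) (suc b') (s≤s z≤n)
            (≤-pred (subst (suc (suc b') ≤_) (par-dep u u≢r) q)) xb
      minimal : ∀ i → 1 ≤ i → i < suc (NearestX.h N) → ¬ X (up i u)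
      minimal (suc zero) _ _ = nxp
      minimal (suc (suc i)) _ (s≤s lt) = NearestX.minimal N (suc i) (s≤s z≤n) lt

  Middle-nearest-X : ∀ {u} → Middle u → Σ ℕ λ h → nearest-X u ≡ up h u × h < L × ThinAbove (suc h) u × h ≤ dep u
  Middle-nearest-X {u} mr with Middle-X-above mr
  ... | e , xe , bt = h , NearestX.eq N , h<L , thin-above , ≤-trans (NearestX.h≤ N) (Between′.h≤ H)
    where
    H = Between⇒′ bt
    N = nearest-X-spec u (Between′.h H) (Between′.h≥1 H) (Between′.h≤ H) (subst X (Between′.eq H) xe)
    h = NearestX.h N
    thin-below : ThinAbove h u
    thin-below i p q = Between′.ch H i p (<-≤-trans q (NearestX.h≤ N))
    h<L : h < L
    h<L with h <? L
    ... | yes p = p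
    ... | no np with long-thin-chain-X u (proj₁ mr) h (≮⇒≥ np) thin-below
    ... | i , i≥1 , i≤P , xi = ⊥-elim (NearestX.minimal N i i≥1 (<-≤-trans (≤-<-trans i≤P P<L) (≮⇒≥ np)) xi)
    thin-above : ThinAbove (suc h) u
    thin-above i p q with m≤n⇒m<n∨m≡n (≤-pred q)
    ... | inj₁ lt = thin-below i p lt
    ... | inj₂ refl = X-thin (NearestX.X-at N)

  -- The nearest X-vertex above the attachment point is constant on each component of F.
  F-label : Fin n → Fin n
  F-label y = nearest-X (att y)

  F-label-par : ∀ x → x ≢ r → InF x → InF (par x) → F-label x ≡ F-label (par x)
  F-label-par x ne fx fp with Big? x
  ... | no nbx = cong nearest-X (att-par x nbx)
  ... | yes bx = trans (cong nearest-X (att-Big x bx))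
                   (trans (nearest-X-par x ne (Kept⇒¬X bp (proj₁ fp))) (cong nearest-X (sym (att-Big (par x) bp))))
    where bp = Big-up (desc-par x) bx

  reach-F-label : ∀ {y₀ y} → Reach F y₀ y → F-label y₀ ≡ F-label y
  reach-F-label (here _) = refl
  reach-F-label (step (inj₁ (xr , refl) , fx , fz) w) = trans (F-label-par _ xr fx fz) (reach-F-label w)
  reach-F-label (step (inj₂ (zr , refl) , fx , fz) w) = trans (sym (F-label-par _ zr fz fx)) (reach-F-label w)

  F-components-small : ∀ m → W * L ≤ m → SmallComponents F m
  F-components-small m WL≤m y₀ f₀ =
    AtMost-via-att Q Q? m (λ y w → proj₂ (reach-end (Induced-isGraph InF) w) , sym (reach-F-label w))
      (≤-trans (∑-att-thin Q Q? (λ u q → Middle-thin (proj₁ q)) (λ u → (dep u ∸ dep z) mod L) inj) WL≤m)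
    where
    z = F-label y₀
    Q : Fin n → Set
    Q u = Middle u × nearest-X u ≡ z
    Q? : ∀ u → Dec (Q u)
    Q? u = Middle? u ×-dec (nearest-X u ≟F z)
    inj : ∀ u u' → Q u → Q u' → (dep u ∸ dep z) mod L ≡ (dep u' ∸ dep z) mod L → u ≡ u'
    inj u u' (mr , eu) (mr' , eu') e with Middle-nearest-X mr | Middle-nearest-X mr'
    ... | h , nu , h<L , ch , h≤ | h' , nu' , h'<L , _ , h'≤ =
      Big-below-thin-unique h u u' (proj₁ mr) (proj₁ mr') (trans (sym zu) (trans zu' (cong (λ k → up k u') (sym h≡h'))))
        (λ i p q → ch i p (s≤s q))
      where
      zu : z ≡ up h u
      zu = trans (sym eu) nu
      zu' : z ≡ up h' u'
      zu' = trans (sym eu') nu'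
      h≡h' : h ≡ h'
      h≡h' = mod-L-injective h<L h'<L (begin
        h mod L                   ≡⟨ cong (_mod L) (trans (cong (λ k → dep u ∸ dep k) zu) (dep-up-≤ h u h≤)) ⟨
        (dep u ∸ dep z) mod L     ≡⟨ e ⟩
        (dep u' ∸ dep z) mod L    ≡⟨ cong (_mod L) (trans (cong (λ k → dep u' ∸ dep k) zu') (dep-up-≤ h' u' h'≤)) ⟩
        h' mod L                  ∎)
        where open ≡-Reasoning

module Paths {n : ℕ} (T : Graph n) (isG : IsGraph T) (allV : ∀ x → V T x) (R : Rooted T)
             (W : ℕ) (W≤n : W ≤ n) (q₁ J j : ℕ) (q₁≥1 : 1 ≤ q₁) (j≤J : j ≤ J) where

  open ComponentBounds T isG allV R W W≤n q₁ J j q₁≥1 j≤J public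

  ancestors-from : Fin n → ℕ → ℕ → List (Fin n)
  ancestors-from c i zero = []
  ancestors-from c i (suc k) = up i c ∷ ancestors-from c (suc i) k

  strip-path : Fin n → PathData n
  strip-path c = mkPath c (ancestors-from c 1 q₁) (up (suc q₁) c)

  ancestors-from-snoc : ∀ c i k → ancestors-from c i k ++ [ up (i + k) c ] ≡ ancestors-from c i (suc k)
  ancestors-from-snoc c i zero = cong (λ z → [ up z c ]) (+-identityʳ i)
  ancestors-from-snoc c i (suc k) = cong (up i c ∷_) (trans (cong (λ z → ancestors-from c (suc i) k ++ [ up z c ]) (+-suc i k)) (ancestors-from-snoc c (suc i) k))

  strip-path-vertices : ∀ c → pathVerts (strip-path c) ≡ ancestors-from c 0 (suc (suc q₁))
  strip-path-vertices c = cong (c ∷_) (ancestors-from-snoc c 1 q₁)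

  length-ancestors-from : ∀ c i k → length (ancestors-from c i k) ≡ k
  length-ancestors-from c i zero = refl
  length-ancestors-from c i (suc k) = cong suc (length-ancestors-from c (suc i) k)

  ∈-ancestors-from⁻ : ∀ c s k u → u ∈ ancestors-from c s k → Σ ℕ λ d → d < k × u ≡ up (s + d) c
  ∈-ancestors-from⁻ c s (suc k) u (here e) = 0 , s≤s z≤n , trans e (cong (λ z → up z c) (sym (+-identityʳ s)))
  ∈-ancestors-from⁻ c s (suc k) u (there m) with ∈-ancestors-from⁻ c (suc s) k u m
  ... | d , lt , e = suc d , s≤s lt , trans e (cong (λ z → up z c) (sym (+-suc s d)))

  consec-ancestors-from : ∀ c s k d → suc d < k → Consec (ancestors-from c s k) (up (s + d) c) (up (s + suc d) c)
  consec-ancestors-from c s (suc (suc k)) zero _ = [] , ancestors-from c (suc (suc s)) k ,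
    cong₂ (λ a b → up a c ∷ up b c ∷ ancestors-from c (suc (suc s)) k) (sym (+-identityʳ s)) (trans (+-comm 1 s) refl)
  consec-ancestors-from c s (suc k) (suc d) (s≤s lt) with consec-ancestors-from c (suc s) k d lt
  ... | ys , zs , e = up s c ∷ ys , zs , cong (up s c ∷_) (trans e (cong₂ (λ a b → ys ++ up a c ∷ up b c ∷ zs) (sym (+-suc s d)) (sym (+-suc s (suc d)))))

  linked-ancestors-from : ∀ c s k → s + k ≤ suc (dep c) → Linked (E T) (ancestors-from c s k)
  linked-ancestors-from c s zero _ = []
  linked-ancestors-from c s (suc zero) _ = [-]
  linked-ancestors-from c s (suc (suc k)) le =
    subst (E T (up s c)) (sym (up-suc s c)) (par-E (up s c) (<dep⇒up≢r s c s<dep)) ∷ linked-ancestors-from c (suc s) (suc k) le′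
    where
    le′ : suc s + suc k ≤ suc (dep c)
    le′ = subst (_≤ suc (dep c)) (+-suc s (suc k)) le
    s<dep : s < dep c
    s<dep = <-≤-trans (m<m+n s (s≤s z≤n)) (≤-pred le′)

  unique-ancestors-from : ∀ c s k → s + k ≤ suc (dep c) → Unique (ancestors-from c s k)
  unique-ancestors-from c s zero _ = []
  unique-ancestors-from c s (suc k) le = All.tabulate fresh ∷ unique-ancestors-from c (suc s) k le′
    where
    le′ : suc s + k ≤ suc (dep c)
    le′ = subst (_≤ suc (dep c)) (+-suc s k) le
    fresh : ∀ {u} → u ∈ ancestors-from c (suc s) k → up s c ≢ u
    fresh {u} m e with ∈-ancestors-from⁻ c (suc s) k u m
    ... | d , d<k , refl = <⇒≢ (∸-monoʳ-< (s≤s (m≤m+n s d)) (≤-pred (<-≤-trans (+-monoʳ-< (suc s) d<k) le′)))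
                             (trans (sym (dep-up (suc s + d) c)) (trans (cong dep (sym e)) (dep-up s c)))

  T₁-isGraph : IsGraph T₁
  T₁-isGraph = record { ends = en ; sym = sy ; loopless = lo }
    where
    en : ∀ {x y} → E T₁ x y → V T₁ x × V T₁ y
    en (inj₁ (pe , tx , ty)) = inj₁ tx , inj₁ ty
    en (inj₂ (v , tv , pe , sx , sy')) = inj₂ (v , tv , sx) , inj₂ (v , tv , sy')
    sy : ∀ {x y} → E T₁ x y → E T₁ y x
    sy (inj₁ (pe , tx , ty)) = inj₁ (PE-sym pe , ty , tx)
    sy (inj₂ (v , tv , pe , sx , sy')) = inj₂ (v , tv , PE-sym pe , sy' , sx)
    lo : ∀ {x} → ¬ E T₁ x x
    lo (inj₁ (pe , _)) = PE-irrefl pe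
    lo (inj₂ (_ , _ , pe , _)) = PE-irrefl pe

  T₂-isGraph : IsGraph T₂
  T₂-isGraph = record { ends = en ; sym = sy ; loopless = lo }
    where
    en : ∀ {x y} → E T₂ x y → V T₂ x × V T₂ y
    en (inj₁ e) = inj₁ (proj₁ (IsGraph.ends T₁-isGraph e)) , inj₁ (proj₂ (IsGraph.ends T₁-isGraph e))
    en (inj₂ (pe , fx , fy)) = inj₂ fx , inj₂ fy
    sy : ∀ {x y} → E T₂ x y → E T₂ y x
    sy (inj₁ e) = inj₁ (IsGraph.sym T₁-isGraph e)
    sy (inj₂ (pe , fx , fy)) = inj₂ (PE-sym pe , fy , fx)
    lo : ∀ {x} → ¬ E T₂ x x
    lo (inj₁ e) = IsGraph.loopless T₁-isGraph e
    lo (inj₂ (pe , _)) = PE-irrefl pe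

  T₂⊆T : T₂ ⊆G T
  T₂⊆T = (λ {x} _ → allV x) , λ e → PE-E (proj₁ (T₂-edge e))

  paths : List (PathData n)
  paths = map strip-path (filter StripStart? (allFin n))

  ∈-paths⁻ : ∀ {P'} → P' ∈ paths → Σ (Fin n) λ c → StripStart c × P' ≡ strip-path c
  ∈-paths⁻ m with ∈ₚ.∈-map∘filter⁻ strip-path StripStart? {xs = allFin n} m
  ... | c , _ , e , st = c , st , e

  strip-path∈paths : ∀ {c} → StripStart c → strip-path c ∈ paths
  strip-path∈paths {c} st = ∈ₚ.∈-map⁺ strip-path (∈ₚ.∈-filter⁺ StripStart? (∈ₚ.∈-allFin c) st)

  strip-path-unique : ∀ {c} → StripStart c → Unique (pathVerts (strip-path c))
  strip-path-unique {c} st = subst Unique (sym (strip-path-vertices c)) (unique-ancestors-from c 0 (suc (suc q₁)) (s≤s (StripStart-deep st)))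

  strip-path-linked : ∀ {c} → StripStart c → Linked (E T) (pathVerts (strip-path c))
  strip-path-linked {c} st = subst (Linked (E T)) (sym (strip-path-vertices c)) (linked-ancestors-from c 0 (suc (suc q₁)) (s≤s (StripStart-deep st)))

  par-StripStart-X : ∀ {c} → StripStart c → X (par c)
  par-StripStart-X {c} st = c , st , 0 , q₁≥1 , refl

  T₂-reach-stays-below-X : ∀ {z} → Big z → X z → ∀ {x y} → Reach T₂ x y → desc z x → desc z y
  T₂-reach-stays-below-X bz xz (here _) d = d
  T₂-reach-stays-below-X {z} bz xz (step e w) d with T₂-edge e
  ... | inj₁ (xr , refl) , kx , ky = T₂-reach-stays-below-X bz xz w (desc-to-par d (λ eq → kx (subst X (sym (trans (cong att eq) (att-Big z bz))) xz)))
  ... | inj₂ (yr , refl) , kx , ky = T₂-reach-stays-below-X bz xz w (desc-from-par d)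

  strip-path-disconnected : ∀ {c} → StripStart c → ¬ Reach T₂ c (up (suc q₁) c)
  strip-path-disconnected {c} st w = <⇒≱ lt (desc-dep (T₂-reach-stays-below-X (X-Big (par-StripStart-X st)) (par-StripStart-X st) w (desc-par c)))
    where
    lt : dep (up (suc q₁) c) < dep (par c)
    lt = subst₂ _<_ (sym (dep-up (suc q₁) c)) (sym (dep-up 1 c)) (∸-monoʳ-< (s≤s q₁≥1) (StripStart-deep st))

  strip-path-interior-cut : ∀ {c} → StripStart c → All (λ u → ¬ V T₂ u) (ancestors-from c 1 q₁)
  strip-path-interior-cut {c} st = All.tabulate λ {u} m → cut u (∈-ancestors-from⁻ c 1 q₁ u m)
    where
    cut : ∀ u → (Σ ℕ λ d → d < q₁ × u ≡ up (1 + d) c) → ¬ V T₂ u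
    cut u (d , lt , e) vu = T₂⇒Kept vu (subst X (sym (att-Big u (X-Big xu))) xu)
      where
      xu : X u
      xu = c , st , d , lt , e

  StripStart-T₂ : ∀ {c} → StripStart c → V T₂ c
  StripStart-T₂ {c} st = Kept⇒T₂ c (¬X⇒Kept (proj₁ st) (StripStart-¬X st))

  StripEnd-T₂ : ∀ {c} → StripStart c → V T₂ (up (suc q₁) c)
  StripEnd-T₂ {c} st = Kept⇒T₂ _ (¬X⇒Kept (Big-up (desc-up (suc q₁) c) (proj₁ st)) (StripEnd-¬X st))

  GoodPath : ℕ → PathData n → Set
  GoodPath q P' = suc (length (interior P')) ≡ q
             × Unique (pathVerts P')
             × Linked (E T) (pathVerts P')
             × V T₂ (start P') × V T₂ (end P')
             × ¬ Reach T₂ (start P') (end P')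
             × All (λ u → ¬ V T₂ u) (interior P')

  paths-good : ∀ q → suc q₁ ≡ q → All (GoodPath q) paths
  paths-good q e = Allₚ.map⁺ (All.map good (Allₚ.all-filter StripStart? (allFin n)))
    where
    good : ∀ {c} → StripStart c → GoodPath q (strip-path c)
    good {c} st = trans (cong suc (length-ancestors-from c 1 q₁)) e , strip-path-unique st , strip-path-linked st , StripStart-T₂ st , StripEnd-T₂ st , strip-path-disconnected st , strip-path-interior-cut st

  strips-share⇒≡ : ∀ {c c' u} → StripStart c → StripStart c' → u ∈ ancestors-from c 1 q₁ → u ∈ ancestors-from c' 1 q₁ → c ≡ c'
  strips-share⇒≡ {c} {c'} {u} st st' m m' with ∈-ancestors-from⁻ c 1 q₁ u m | ∈-ancestors-from⁻ c' 1 q₁ u m'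
  ... | d , lt , e | d' , lt' , e' = strips-disjoint st st' lt lt' (trans (sym e) e')

  lookup-map-strip-path : ∀ (cs : List (Fin n)) (i : Fin (length (map strip-path cs))) → Σ (Fin n) λ c → c ∈ cs × lookup (map strip-path cs) i ≡ strip-path c
  lookup-map-strip-path (c ∷ cs) zero = c , here refl , refl
  lookup-map-strip-path (c ∷ cs) (suc i) with lookup-map-strip-path cs i
  ... | c' , m , e = c' , there m , e

  strip-interiors-disjoint : ∀ (cs : List (Fin n)) → Unique cs → All StripStart cs → ∀ (i k : Fin (length (map strip-path cs))) → i ≢ k →
          ∀ u → u ∈ interior (lookup (map strip-path cs) i) → ¬ u ∈ interior (lookup (map strip-path cs) k)
  strip-interiors-disjoint (c ∷ cs) (hd ∷ un) (st ∷ al) zero zero ne = ⊥-elim (ne refl)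
  strip-interiors-disjoint (c ∷ cs) (hd ∷ un) (st ∷ al) zero (suc k) ne u m m' with lookup-map-strip-path cs k
  ... | c' , mc , e = Data.List.Relation.Unary.All.lookup hd mc
                        (strips-share⇒≡ st (Data.List.Relation.Unary.All.lookup al mc) m (subst (λ z → u ∈ interior z) e m'))
    where import Data.List.Relation.Unary.All
  strip-interiors-disjoint (c ∷ cs) (hd ∷ un) (st ∷ al) (suc i) zero ne u m m' with lookup-map-strip-path cs i
  ... | c' , mc , e = Data.List.Relation.Unary.All.lookup hd mc
                        (strips-share⇒≡ st (Data.List.Relation.Unary.All.lookup al mc) m' (subst (λ z → u ∈ interior z) e m))
    where import Data.List.Relation.Unary.All
  strip-interiors-disjoint (c ∷ cs) (hd ∷ un) (st ∷ al) (suc i) (suc k) ne = strip-interiors-disjoint cs un al i k (λ e → ne (cong suc e))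

  paths-interiors-disjoint : ∀ (i k : Fin (length paths)) → i ≢ k → ∀ u → u ∈ interior (lookup paths i) → ¬ u ∈ interior (lookup paths k)
  paths-interiors-disjoint = strip-interiors-disjoint (filter StripStart? (allFin n))
    (Uniqueₚ.filter⁺ StripStart? (Uniqueₚ.allFin⁺ n)) (Allₚ.all-filter StripStart? (allFin n))

  T₃ : Graph n
  T₃ = record { V = λ x → V T₂ x ⊎ Σ (PathData n) λ P' → P' ∈ paths × x ∈ pathVerts P'
               ; E = λ x y → E T₂ x y ⊎ Σ (PathData n) λ P' → P' ∈ paths × (Consec (pathVerts P') x y ⊎ Consec (pathVerts P') y x) }

  T₃-isGraph : IsGraph T₃
  T₃-isGraph = record { ends = en ; sym = sy ; loopless = lo }
    where
    en : ∀ {x y} → E T₃ x y → V T₃ x × V T₃ y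
    en (inj₁ e) = inj₁ (proj₁ (IsGraph.ends T₂-isGraph e)) , inj₁ (proj₂ (IsGraph.ends T₂-isGraph e))
    en (inj₂ (P' , m , inj₁ cs)) = inj₂ (P' , m , proj₁ (consec-∈ cs)) , inj₂ (P' , m , proj₂ (consec-∈ cs))
    en (inj₂ (P' , m , inj₂ cs)) = inj₂ (P' , m , proj₂ (consec-∈ cs)) , inj₂ (P' , m , proj₁ (consec-∈ cs))
    sy : ∀ {x y} → E T₃ x y → E T₃ y x
    sy (inj₁ e) = inj₁ (IsGraph.sym T₂-isGraph e)
    sy (inj₂ (P' , m , inj₁ cs)) = inj₂ (P' , m , inj₂ cs)
    sy (inj₂ (P' , m , inj₂ cs)) = inj₂ (P' , m , inj₁ cs)
    uq : ∀ {P'} → P' ∈ paths → Unique (pathVerts P')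
    uq m with ∈-paths⁻ m
    ... | c , st , refl = strip-path-unique st
    lo : ∀ {x} → ¬ E T₃ x x
    lo (inj₁ e) = IsGraph.loopless T₂-isGraph e
    lo (inj₂ (P' , m , inj₁ cs)) = consec-irrefl (uq m) cs
    lo (inj₂ (P' , m , inj₂ cs)) = consec-irrefl (uq m) cs

  T₃⊆T : T₃ ⊆G T
  T₃⊆T = (λ {x} _ → allV x) , ed
    where
    lk : ∀ {P'} → P' ∈ paths → Linked (E T) (pathVerts P')
    lk m with ∈-paths⁻ m
    ... | c , st , refl = strip-path-linked st
    ed : ∀ {x y} → E T₃ x y → E T x y
    ed (inj₁ e) = PE-E (proj₁ (T₂-edge e))
    ed (inj₂ (P' , m , inj₁ cs)) = consec-linked (lk m) cs
    ed (inj₂ (P' , m , inj₂ cs)) = IsGraph.sym isG (consec-linked (lk m) cs)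

  reach-along-strip : ∀ {c} → StripStart c → ∀ d i → i + d ≡ suc q₁ → Reach T₃ (up i c) (up (suc q₁) c)
  reach-along-strip {c} st zero i e = subst (λ z → Reach T₃ (up z c) (up (suc q₁) c)) (sym (trans (sym (+-identityʳ i)) e)) (here (inj₁ (StripEnd-T₂ st)))
  reach-along-strip {c} st (suc d) i e = step (inj₂ (strip-path c , strip-path∈paths st , inj₁ cs)) (reach-along-strip st d (suc i) (trans (sym (+-suc i d)) e))
    where
    lt : suc i < suc (suc q₁)
    lt = s≤s (subst (suc i ≤_) e (subst (_≤ i + suc d) (+-comm i 1) (+-monoʳ-≤ i (s≤s z≤n))))
    cs : Consec (pathVerts (strip-path c)) (up i c) (up (suc i) c)
    cs = subst (λ xs → Consec xs (up i c) (up (suc i) c)) (sym (strip-path-vertices c)) (consec-ancestors-from c 0 (suc (suc q₁)) i lt)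

  T₂-exit⇒StripStart : ∀ x → x ≢ r → V T₂ x → ¬ Kept (par x) → StripStart x
  T₂-exit⇒StripStart x x≢r vx nkp with Big? x
  ... | no nbx = ⊥-elim (nkp (subst (λ z → ¬ X z) (att-par x nbx) (T₂⇒Kept vx)))
  ... | yes bx with subst X (att-Big (par x) (Big-up (desc-par x) bx)) (decidable-stable (X? (att (par x))) nkp)
  ... | c , st , i , i<q₁ , e = by-index i refl
    where
    x≡up : x ≡ up i c
    x≡up = #bigChildren≡1-unique (thin-one-child (subst thin (sym e) (StripStart-thin st (suc i) (s≤s z≤n) i<q₁)))
             (x≢r , refl , bx)
             (subst (BigChild (up i c)) (sym e) (BigChild-up i (proj₁ st) (StripStart-up≢r st (suc i) i<q₁)))
    by-index : ∀ k → i ≡ k → StripStart x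
    by-index zero refl = subst StripStart (sym x≡up) st
    by-index (suc k) refl = ⊥-elim (Kept⇒¬X bx (T₂⇒Kept vx) (subst X (sym x≡up) (c , st , k , <-trans (n<1+n k) i<q₁ , refl)))

  T₂-reach-r : ∀ f x → dep x ≤ f → V T₂ x → Reach T₃ x r
  T₂-reach-r zero x le vx = subst (λ z → Reach T₃ z r) (sym (dep≡0 x (n≤0⇒n≡0 le))) (here (inj₁ (subst (V T₂) (dep≡0 x (n≤0⇒n≡0 le)) vx)))
  T₂-reach-r (suc f) x le vx with x ≟F r
  ... | yes refl = here (inj₁ vx)
  ... | no ne with Kept? (par x)
  ...   | yes kp = step (inj₁ (kept-edge x ne (T₂⇒Kept vx) kp)) (T₂-reach-r f (par x) (≤-pred (subst (_≤ suc f) (par-dep x ne) le)) (Kept⇒T₂ (par x) kp))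
  ...   | no nkp = reach-++ T₃-isGraph (reach-along-strip st (suc q₁) 0 refl) (T₂-reach-r f (up (suc q₁) x) le' (StripEnd-T₂ st))
    where
    st = T₂-exit⇒StripStart x ne vx nkp
    le' : dep (up (suc q₁) x) ≤ f
    le' = ≤-pred (≤-trans (subst (_< dep x) (sym (dep-up (suc q₁) x)) (∸-monoʳ-< {dep x} {suc q₁} {0} (s≤s z≤n) (StripStart-deep st))) le)

  T₃-reach-r : ∀ x → V T₃ x → Reach T₃ x r
  T₃-reach-r x (inj₁ vx) = T₂-reach-r (dep x) x ≤-refl vx
  T₃-reach-r x (inj₂ (P' , m , mx)) with ∈-paths⁻ m
  ... | c , st , refl with ∈-ancestors-from⁻ c 0 (suc (suc q₁)) x (subst (x ∈_) (strip-path-vertices c) mx)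
  ...   | d , lt , refl = reach-++ T₃-isGraph (reach-along-strip st (suc q₁ ∸ d) d (m+[n∸m]≡n (≤-pred lt))) (T₂-reach-r (dep (up d c)) (up (suc q₁) c) le' (StripEnd-T₂ st))
    where
    le' : dep (up (suc q₁) c) ≤ dep (up d c)
    le' = subst₂ _≤_ (sym (dep-up (suc q₁) c)) (sym (dep-up d c)) (∸-monoʳ-≤ (dep c) (≤-pred lt))

  T₃-tree : ¬ Cycle T → IsTree T₃
  T₃-tree acyclic = (T₃-isGraph , acyclic-⊆ T₃⊆T acyclic) , connected-via T₃-isGraph r r∈T₃ T₃-reach-r , r , r∈T₃
    where
    r∈T₃ : V T₃ r
    r∈T₃ = inj₁ (inj₁ (inj₁ (special-InT₀ special-r)))

module Decomposition {n : ℕ} (T : Graph n) (isG : IsGraph T) (allV : ∀ x → V T x) (R : Rooted T)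
                     (W : ℕ) (W≤n : W ≤ n) (q₁ J j : ℕ) (q₁≥1 : 1 ≤ q₁) (j≤J : j ≤ J) where

  open Paths T isG allV R W W≤n q₁ J j q₁≥1 j≤J public
  open SpecialCount T isG allV R W W≤n using (#special; W*#special≤3n)

  ThinT₀ : Fin n → Set
  ThinT₀ u = thin u × Kept u × ¬ X-above u × ¬ X-below u

  ThinT₀? : ∀ u → Dec (ThinT₀ u)
  ThinT₀? u = thin? u ×-dec (Kept? u ×-dec (¬? (X-above? u) ×-dec ¬? (X-below? u)))

  -- A thin vertex of T₀ lies on an uncut chain, less than L above the special vertex below it.
  #ThinT₀≤ : ∑ (λ u → 𝟙 (ThinT₀? u)) ≤ L * #special
  #ThinT₀≤ = begin
      ∑ (λ u → 𝟙 (ThinT₀? u))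
    ≤⟨ ∑-covered (λ u → 𝟙 (ThinT₀? u)) (λ s (i : Fin L) → 𝟙 (special? s)) (λ s i → up (toℕ i) s) (λ u → 𝟙≤1 (ThinT₀? u)) below-special ⟩
      ∑ (λ s → ∑ {L} (λ i → 𝟙 (special? s)))
    ≡⟨ ∑-cong (λ s → ∑-const {L} (𝟙 (special? s))) ⟩
      ∑ (λ s → L * 𝟙 (special? s))
    ≡⟨ ∑-*ˡ L (λ s → 𝟙 (special? s)) ⟩
      L * #special
    ∎
    where
    open ≤-Reasoning
    below-special : ∀ u → 1 ≤ 𝟙 (ThinT₀? u) → Σ (Fin n) λ s → Σ (Fin L) λ i → u ≡ up (toℕ i) s × 1 ≤ 𝟙 (special? s)
    below-special u p with 𝟙-pos (ThinT₀? u) p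
    ... | tu , ku , na , nb with special-below u tu
    ... | s , sp , H = s , fromℕ< h<L , trans (Between′.eq H) (cong (λ k → up k s) (sym (toℕ-fromℕ< h<L))) ,
                       ≤-reflexive (sym (𝟙-yes (special? s) sp))
      where
      h<L : Between′.h H < L
      h<L = ¬X-below⇒short nb (proj₁ sp) H

  #T₀≤ : ∑ (λ u → 𝟙 (InT₀? u)) ≤ suc L * #special
  #T₀≤ = begin
      ∑ (λ u → 𝟙 (InT₀? u))
    ≤⟨ ∑-mono (λ u → split u (InT₀? u) (special? u) (ThinT₀? u)) ⟩
      ∑ (λ u → 𝟙 (special? u) + 𝟙 (ThinT₀? u))
    ≡⟨ ∑-+ (λ u → 𝟙 (special? u)) (λ u → 𝟙 (ThinT₀? u)) ⟩
      #special + ∑ (λ u → 𝟙 (ThinT₀? u))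
    ≤⟨ +-monoʳ-≤ #special #ThinT₀≤ ⟩
      #special + L * #special
    ∎
    where
    open ≤-Reasoning
    split : ∀ u (d : Dec (InT₀ u)) (e : Dec (special u)) (f : Dec (ThinT₀ u)) → 𝟙 d ≤ 𝟙 e + 𝟙 f
    split u (no _) e f = z≤n
    split u (yes _) (yes _) f = s≤s z≤n
    split u (yes (_ , _ , inj₁ sp)) (no nsp) f = ⊥-elim (nsp sp)
    split u (yes (_ , ku , inj₂ (tu , na , nb))) (no _) (yes _) = s≤s z≤n
    split u (yes (_ , ku , inj₂ (tu , na , nb))) (no _) (no nt) = ⊥-elim (nt (tu , ku , na , nb))

  F∩T₁ : ∀ x → V F x → ¬ V T₁ x
  F∩T₁ x (kx , mr) (inj₁ t₀) = InT₀-¬Middle t₀ (subst Middle (att-Big x (InT₀-Big t₀)) mr)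
  F∩T₁ x (kx , mr) (inj₂ (v , tv , (_ , inj₁ refl))) = InT₀-¬Middle tv (subst Middle (att-Big v (InT₀-Big tv)) mr)
  F∩T₁ x (kx , mr) (inj₂ (v , tv , (_ , inj₂ (_ , inj₁ e)))) = InT₀-¬Middle tv (subst Middle e mr)
  F∩T₁ x (kx , mr) (inj₂ (v , tv , (_ , inj₂ (_ , inj₂ (inj₁ (tr , _)))))) = Upper-¬Middle tr mr
  F∩T₁ x (kx , mr) (inj₂ (v , tv , (_ , inj₂ (_ , inj₂ (inj₂ (br , _)))))) = Lower-¬Middle br mr

  T₁⊆T : T₁ ⊆G T
  T₁⊆T = (λ {x} _ → allV x) , λ { (inj₁ (pe , _)) → PE-E pe ; (inj₂ (_ , _ , pe , _)) → PE-E pe }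

  outside-T₂⇒X-att : ∀ x → ¬ V T₂ x → X (att x)
  outside-T₂⇒X-att x nv = decidable-stable (X? (att x)) (λ kx → nv (Kept⇒T₂ x kx))

  -- The paper's η is (suc a)/(suc b); the bounds below only need η ≥ 1/(suc b).
  AtMostFrac-via-∑ : ∀ {Q : Fin n → Set} (a b : ℕ) (g : Fin n → ℕ) → (∀ x → Q x → 1 ≤ g x) → suc b * ∑ g ≤ n →
                     AtMostFrac Q a b n
  AtMostFrac-via-∑ a b g Q⇒pos bound xs u all = begin
      suc b * length xs   ≤⟨ *-monoʳ-≤ (suc b) (length≤∑ xs u all g Q⇒pos) ⟩
      suc b * ∑ g         ≤⟨ bound ⟩
      n                   ≤⟨ m≤m+n n (a * n) ⟩
      suc a * n           ∎
    where open ≤-Reasoning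

  T₀-small : ∀ a → W ≡ 3 * (suc L * suc J) → AtMostFrac (V T₀) a J n
  T₀-small a W≡ = AtMostFrac-via-∑ a J (λ u → 𝟙 (InT₀? u)) (λ x t → ≤-reflexive (sym (𝟙-yes (InT₀? x) t)))
    (*-cancelˡ-≤ 3 (begin
      3 * (suc J * ∑ (λ u → 𝟙 (InT₀? u)))   ≤⟨ *-monoʳ-≤ 3 (*-monoʳ-≤ (suc J) #T₀≤) ⟩
      3 * (suc J * (suc L * #special))       ≡⟨ rearrange (suc J) (suc L) #special ⟩
      3 * (suc L * suc J) * #special         ≡⟨ cong (_* #special) W≡ ⟨
      W * #special                           ≤⟨ W*#special≤3n ⟩
      3 * n                                  ∎))
    where
    open ≤-Reasoning
    open import Data.Nat.Solver using (module +-*-Solver)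
    open +-*-Solver
    rearrange : ∀ x y z → 3 * (x * (y * z)) ≡ 3 * (y * x) * z
    rearrange = solve 3 (λ x y z → con 3 :* (x :* (y :* z)) := con 3 :* (y :* x) :* z) refl

  cut-small : ∀ a → suc J * ∑ (λ x → 𝟙 (X? (att x))) ≤ n → AtMostFrac (λ x → V T x × ¬ (V T₂ x)) a J n
  cut-small a bound = AtMostFrac-via-∑ a J (λ x → 𝟙 (X? (att x)))
    (λ x (_ , nv) → ≤-reflexive (sym (𝟙-yes (X? (att x)) (outside-T₂⇒X-att x nv)))) bound

  pendant-trees : ¬ Cycle T → ∀ m → W * L ≤ m → AddPendantTrees T T₀ T₁ m
  pendant-trees acyclic m WL≤m =
    S , (λ v tv → S-tree v tv acyclic , Induced-⊆ (InS v) , (InT₀-Kept tv , inj₁ refl) , (λ _ → S∩T₀) ,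
                  S-components-small v tv m WL≤m) ,
        (λ v w → S-disjoint) , (λ x → id , id) , (λ x y → id , id)

  small-forest : ¬ Cycle T → ∀ m → W * L ≤ m → AddSmallForest T T₁ T₂ m
  small-forest acyclic m WL≤m =
    F , Induced-forest acyclic InF , Induced-⊆ InF , F-components-small m WL≤m , F∩T₁ , (λ x → id , id) , (λ x y → id , id)

  connecting-paths : ConnectByPaths T T₂ T₃ (suc q₁)
  connecting-paths = paths , paths-good (suc q₁) refl , paths-interiors-disjoint , (λ x → id , id) , (λ x y → id , id)

TreeDecomposition : ∀ {n} → Graph n → (a b m q : ℕ) → Set₁
TreeDecomposition {n} T a b m q =
  Σ (Graph n) λ T₀ → Σ (Graph n) λ T₁ → Σ (Graph n) λ T₂ → Σ (Graph n) λ T₃ →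
    IsForest T₀ × IsForest T₁ × IsForest T₂ × IsTree T₃
    × (T₀ ⊆G T₁) × (T₁ ⊆G T₂) × (T₂ ⊆G T₃) × (T₃ ⊆G T)
    × AtMostFrac (V T₀) a b n
    × AddPendantTrees T T₀ T₁ m
    × AddSmallForest T T₁ T₂ m
    × ConnectByPaths T T₂ T₃ q
    × AtMostFrac (λ x → V T x × ¬ (V T₂ x)) a b n

-- L = P + q₁ bounds the uncut thin chains, where P = 2 + (b + 1) q₁ is the period of the strips and q₁ = q₂ + 1.
chain-bound : ℕ → ℕ → ℕ
chain-bound b q₂ = (2 + suc b * suc q₂) + suc q₂

big-threshold : ℕ → ℕ → ℕ
big-threshold b q₂ = 3 * (suc (chain-bound b q₂) * suc b)

InWindow-unique : ∀ {q₁ j₁ j₂ ρ} → j₁ * q₁ < ρ × ρ ≤ suc j₁ * q₁ → j₂ * q₁ < ρ × ρ ≤ suc j₂ * q₁ → j₁ ≡ j₂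
InWindow-unique {q₁} {j₁} {j₂} (l₁ , u₁) (l₂ , u₂) with <-cmp j₁ j₂
... | tri≈ _ e _ = e
... | tri< lt _ _ = ⊥-elim (<⇒≱ (<-≤-trans l₂ u₁) (*-monoˡ-≤ q₁ lt))
... | tri> _ _ gt = ⊥-elim (<⇒≱ (<-≤-trans l₁ u₂) (*-monoˡ-≤ q₁ gt))

module _ (a b q₂ m : ℕ) (WL≤m : big-threshold b q₂ * chain-bound b q₂ ≤ m)
         {n : ℕ} (T : Graph n) (spT : IsSpanningTree T) (W≤n : big-threshold b q₂ ≤ n) where

  private
    W = big-threshold b q₂
    isG : IsGraph T
    isG = proj₁ (proj₁ (proj₁ spT))
    acyclic : ¬ Cycle T
    acyclic = proj₂ (proj₁ (proj₁ spT))
    allV : ∀ x → V T x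
    allV = proj₂ spT
    R : Rooted T
    R = spanning-tree-rooted T spT

    open BigVertices T isG allV R W W≤n using (att)

    module Window (j : Fin (suc b)) =
      Decomposition T isG allV R W W≤n (suc q₂) b (toℕ j) (s≤s z≤n) (≤-pred (toℕ<n j))

    #cut : Fin (suc b) → ℕ
    #cut j = ∑ (λ x → 𝟙 (Window.X? j (att x)))

    -- Each vertex hangs from an X-vertex of at most one window, so some window cuts at most n/(b + 1) vertices.
    ∑-#cut≤n : ∑ #cut ≤ n
    ∑-#cut≤n = begin
        ∑ (λ j → ∑ (λ x → 𝟙 (Window.X? j (att x))))
      ≡⟨ ∑-swap (λ j x → 𝟙 (Window.X? j (att x))) ⟩
        ∑ (λ x → ∑ (λ j → 𝟙 (Window.X? j (att x))))
      ≤⟨ ∑-mono (λ x → ∑-≤1 _ (λ j → 𝟙≤1 (Window.X? j (att x)))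
           (λ j₁ j₂ p₁ p₂ → toℕ-injective (InWindow-unique (Window.X-window j₁ (𝟙-pos (Window.X? j₁ (att x)) p₁))
                                                            (Window.X-window j₂ (𝟙-pos (Window.X? j₂ (att x)) p₂))))) ⟩
        ∑ {n} (λ _ → 1)
      ≡⟨ ∑-one ⟩
        n
      ∎
      where open ≤-Reasoning

    j* : Fin (suc b)
    j* = proj₁ (averaging #cut n ∑-#cut≤n)

    open Window j*

  decompose : TreeDecomposition T a b m (suc (suc q₂))
  decompose =
    T₀ , T₁ , T₂ , T₃ ,
    Induced-forest acyclic InT₀ ,
    (T₁-isGraph , acyclic-⊆ T₁⊆T acyclic) ,
    (T₂-isGraph , acyclic-⊆ T₂⊆T acyclic) ,
    T₃-tree acyclic ,
    (inj₁ , inj₁) , (inj₁ , inj₁) , (inj₁ , inj₁) , T₃⊆T ,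
    T₀-small a refl , pendant-trees acyclic m WL≤m , small-forest acyclic m WL≤m , connecting-paths ,
    cut-small a (proj₂ (averaging #cut n ∑-#cut≤n))

lemma2p1 : (a b : ℕ) → (q : ℕ) → 2 ≤ q →
    Σ ℕ λ m₀ → (m : ℕ) → m₀ ≤ m →
    Σ ℕ λ n₀ → (n : ℕ) → n₀ ≤ n →
    (T : Graph n) → IsSpanningTree T →
    Σ (Graph n) λ T₀ → Σ (Graph n) λ T₁ → Σ (Graph n) λ T₂ → Σ (Graph n) λ T₃ →
      IsForest T₀ × IsForest T₁ × IsForest T₂ × IsTree T₃
      × (T₀ ⊆G T₁) × (T₁ ⊆G T₂) × (T₂ ⊆G T₃) × (T₃ ⊆G T)
      × AtMostFrac (V T₀) a b n
      × AddPendantTrees T T₀ T₁ m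
      × AddSmallForest T T₁ T₂ m
      × ConnectByPaths T T₂ T₃ q
      × AtMostFrac (λ x → V T x × ¬ (V T₂ x)) a b n
lemma2p1 a b (suc (suc q₂)) (s≤s (s≤s z≤n)) =
  big-threshold b q₂ * chain-bound b q₂ , λ m WL≤m →
  big-threshold b q₂ , λ n W≤n T spT → decompose a b q₂ m WL≤m T spT W≤n
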